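{- All odd diamonds and all odd one-directions are minimal obstructions.
   Context: Digraphs may have loops and multiple edges. A bond is an inclusion-minimal nonempty edge cut $D[X,Y]$; it is directed if all its edges go from $X$ to $Y$. An odd dijoin is a set $J$ of edges meeting every directed bond in an odd number of edges. Contracting an edge set $A$: delete $A$ and identify each weak component of $D[A]$ to a vertex. A non-loop edge $(x,y)$ is deletable if there is a directed $x$–$y$ path avoiding it. A cut minor is obtained by a finite sequence of edge contractions, deletions of deletable edges and deletions of isolated vertices; proper if different from $D$. A minimal obstruction is a digraph without an odd dijoin every proper cut minor of which has an odd dijoin. A diamond is a digraph with two vertices $h_1,h_2$ and vertices $x_1,\dots,x_n$, $n\ge3$, where each $x_i$ has either exactly two outgoing edges, one to each of $h_1,h_2$, or exactly two incoming edges, one from each of $h_1,h_2$, and these are all the edges. A one-direction is a digraph isomorphic to $\vec{K}_{n_1,n_2}$ (complete bipartite, all edges oriented from the part of size $n_1$ to the part of size $n_2$) with $n_1,n_2\ge2$. Odd means having an odd number of vertices. -}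

module Defs where

open import Data.Nat using (ℕ; zero; suc; _≤_; _%_)
open import Data.Fin using (Fin; punchIn)
open import Data.Fin.Subset using (Subset; _∈_; _∉_; _⊆_; _∩_; ∣_∣; Nonempty; ∁)
open import Data.Vec using (tabulate; lookup)
open import Data.Bool using (Bool; _xor_)
open import Data.Product using (Σ; ∃; ∃-syntax; _×_; _,_)
open import Data.Sum using (_⊎_)
open import Relation.Nullary using (¬_)
open import Relation.Binary.PropositionalEquality using (_≡_; _≢_)

-- Finite digraphs with loops and multiple edges:
-- vertices Fin n, edges Fin m, each edge e goes from src e to tgt e.

record Digraph (n m : ℕ) : Set where
  constructor digraph
  field
    src : Fin m → Fin n
    tgt : Fin m → Fin n
open Digraph public

module _ {n m : ℕ} (D : Digraph n m) where

  cut : Subset n → Subset m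
  cut X = tabulate (λ e → lookup X (src D e) xor lookup X (tgt D e))

  IsBond : Subset n → Set
  IsBond X = Nonempty (cut X)
           × (∀ (Y : Subset n) → Nonempty (cut Y) → cut Y ⊆ cut X → cut X ⊆ cut Y)

  IsDirectedCut : Subset n → Set
  IsDirectedCut X = ∀ e → e ∈ cut X → src D e ∈ X

  IsOddDijoin : Subset m → Set
  IsOddDijoin J = ∀ (X : Subset n) → IsBond X → IsDirectedCut X → ∣ J ∩ cut X ∣ % 2 ≡ 1

  HasOddDijoin : Set
  HasOddDijoin = ∃[ J ] IsOddDijoin J

  data Path : Fin n → Fin n → Set where
    here  : ∀ {u} → Path u u
    there : ∀ {v} e → Path (tgt D e) v → Path (src D e) v

-- Elementary cut-minor steps.  Contracting an edge set A is the same as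
-- contracting the edges of A one at a time, so single-edge contractions
-- suffice.

DeleteEdge : ∀ {n m} → Digraph n (suc m) → Fin (suc m) → Digraph n m
DeleteEdge D e = digraph (λ f → src D (punchIn e f)) (λ f → tgt D (punchIn e f))

data Step : ∀ {n m n' m'} → Digraph n m → Digraph n' m' → Set where
  delete   : ∀ {n m} (D : Digraph n (suc m)) (e : Fin (suc m)) →
             src D e ≢ tgt D e →
             Path (DeleteEdge D e) (src D e) (tgt D e) →
             Step D (DeleteEdge D e)
  contractLoop : ∀ {n m} (D : Digraph n (suc m)) (e : Fin (suc m)) →
             src D e ≡ tgt D e →
             Step D (DeleteEdge D e)
  -- contraction of a non-loop edge e = (x,y): delete it and identify x with y,
  -- via a map q that identifies exactly x and y
  contractEdge : ∀ {n m} (D : Digraph (suc n) (suc m)) (e : Fin (suc m))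
             (D' : Digraph n m) (q : Fin (suc n) → Fin n) →
             src D e ≢ tgt D e →
             q (src D e) ≡ q (tgt D e) →
             (∀ u v → q u ≡ q v → u ≡ v ⊎ ((u ≡ src D e × v ≡ tgt D e) ⊎ (u ≡ tgt D e × v ≡ src D e))) →
             (∀ f → src D' f ≡ q (src D (punchIn e f))) →
             (∀ f → tgt D' f ≡ q (tgt D (punchIn e f))) →
             Step D D'
  -- deletion of an isolated vertex v
  deleteVertex : ∀ {n m} (D : Digraph (suc n) m) (v : Fin (suc n)) (D' : Digraph n m) →
             (∀ f → src D f ≡ punchIn v (src D' f)) →
             (∀ f → tgt D f ≡ punchIn v (tgt D' f)) →
             Step D D'

data ProperCutMinor : ∀ {n m n' m'} → Digraph n m → Digraph n' m' → Set where
  [_] : ∀ {n m n' m'} {D : Digraph n m} {D' : Digraph n' m'} → Step D D' → ProperCutMinor D D'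
  _∷_ : ∀ {n m n' m' n'' m''} {D : Digraph n m} {D' : Digraph n' m'} {D'' : Digraph n'' m''} →
        Step D D' → ProperCutMinor D' D'' → ProperCutMinor D D''

IsMinimalObstruction : ∀ {n m} → Digraph n m → Set
IsMinimalObstruction D =
  ¬ HasOddDijoin D ×
  (∀ {n' m'} (D' : Digraph n' m') → ProperCutMinor D D' → HasOddDijoin D')

module _ {n m : ℕ} (D : Digraph n m) where

  Incident : Fin n → Fin m → Set
  Incident x e = src D e ≡ x ⊎ tgt D e ≡ x

  OutToHubs InFromHubs : Fin n → Fin n → Fin n → Set
  OutToHubs h₁ h₂ x = ∃[ e₁ ] ∃[ e₂ ]
    (src D e₁ ≡ x × tgt D e₁ ≡ h₁ × src D e₂ ≡ x × tgt D e₂ ≡ h₂ ×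
     (∀ e → Incident x e → e ≡ e₁ ⊎ e ≡ e₂))
  InFromHubs h₁ h₂ x = ∃[ e₁ ] ∃[ e₂ ]
    (src D e₁ ≡ h₁ × tgt D e₁ ≡ x × src D e₂ ≡ h₂ × tgt D e₂ ≡ x ×
     (∀ e → Incident x e → e ≡ e₁ ⊎ e ≡ e₂))

  IsDiamond : Set
  IsDiamond = ∃[ h₁ ] ∃[ h₂ ]
    (h₁ ≢ h₂ ×
     5 ≤ n ×     -- at least three vertices besides h₁, h₂
     (∀ x → x ≢ h₁ → x ≢ h₂ → OutToHubs h₁ h₂ x ⊎ InFromHubs h₁ h₂ x) ×
     -- these are all the edges
     (∀ e → ∃[ x ] (x ≢ h₁ × x ≢ h₂ × Incident x e)))

  -- isomorphic to the complete bipartite digraph with all edges from A to B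
  IsOneDirection : Set
  IsOneDirection = ∃[ A ]
    (2 ≤ ∣ A ∣ × 2 ≤ ∣ ∁ A ∣ ×
     (∀ e → src D e ∈ A × tgt D e ∉ A) ×
     (∀ a b → a ∈ A → b ∉ A → ∃[ e ] (src D e ≡ a × tgt D e ≡ b)) ×
     (∀ e e' → src D e ≡ src D e' → tgt D e ≡ tgt D e' → e ≡ e'))

Odd : ℕ → Set
Odd n = n % 2 ≡ 1

module Submission where

-- Vertex and edge sets are Boolean functions, so that |A ∩ B| mod 2 is a sum A · B in the ring
-- (Bool, xor, ∧). Every cut-minor step turns the directed bonds of the minor into directed bonds
-- of the original digraph with the same cut on the surviving edges (through the parity of the
-- parallel walk, for a deleted edge), so odd dijoins survive all steps and it suffices that every
-- first step leads to a digraph with an odd dijoin. Diamonds and one-directions are graded and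
-- simple without isolated vertices, so the only first steps are contractions of an edge e, after
-- which a set J that is odd on the directed bonds of D missing e is an odd dijoin.
-- The directed bonds of these digraphs are classified: the vertex stars of a one-direction; the
-- stars of the non-hubs and the two hub sides {h} ∪ {sources} of a diamond. These bonds cover
-- every edge an even number of times, so an odd dijoin would force an even number of vertices,
-- while explicit sets J (two vertex stars, resp. a hub side and a star) handle the contractions.

open import Defs
open import Algebra.Bundles using (CommutativeRing)
open import Data.Bool using (Bool; true; false; not; _∧_; _∨_; _xor_; if_then_else_)
open import Data.Bool.Properties
  using ( xor-∧-commutativeRing; xor-same; xor-comm; xor-assoc; xor-identityʳ; xor-inverseˡ; xor-inverseʳ
        ; true-xor; not-involutive; not-injective; not-¬; ¬-not; ⇔→≡
        ; ∧-distribˡ-xor; ∧-distribʳ-xor; ∧-zeroʳ; ∧-comm; ∧-assoc; ∧-inverseʳ )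
import Data.Bool.Properties as Bool
open import Data.Empty using (⊥; ⊥-elim)
open import Data.Fin using (Fin; zero; suc; punchIn; punchOut; _≟_)
open import Data.Fin.Properties
  using (punchInᵢ≢i; punchIn-punchOut; punchOut-punchIn; punchOut-cong; any?; pigeonhole; <⇒≢)
open import Data.Fin.Subset using (Subset; _∈_; _∉_; _⊆_; _∩_; ∁; ⁅_⁆; ∣_∣)
open import Data.Fin.Subset.Properties
  using (_∈?_; nonempty?; Empty-unique; ∣⊥∣≡0; x∈⁅x⁆; ∣⁅x⁆∣≡1; p⊆q⇒∣p∣≤∣q∣; x∈∁p⇒x∉p)
open import Data.Nat using (ℕ; zero; suc; _%_; _≤_; _<_; s≤s; z≤n)
open import Data.Nat.Properties using (≤-refl; ≤-trans; ≤-reflexive; n≤1+n; 1+n≰n)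
open import Data.Product using (∃; ∃-syntax; _×_; _,_; proj₁; proj₂)
open import Data.Sum using (_⊎_; inj₁; inj₂)
open import Data.Vec using ([]; _∷_; lookup; tabulate)
open import Data.Vec.Properties using (lookup∘tabulate; []=⇒lookup; lookup⇒[]=; lookup-zipWith)
open import Function using (_∘_; case_of_)
open import Function.Bundles using (mk⇔)
open import Relation.Nullary using (¬_; ¬?; Dec; does; yes; no)
open import Relation.Nullary.Decidable using (dec-true; dec-false; _×-dec_)
open import Relation.Binary.PropositionalEquality
  using (_≡_; _≢_; refl; sym; trans; cong; cong₂; subst; subst₂; _≗_; module ≡-Reasoning)

open CommutativeRing xor-∧-commutativeRing using (semiring)
open import Algebra.Properties.Semiring.Sum semiring
  using (sum; sum-syntax; sum-cong-≗; sum-remove; sum-replicate-zero; ∑-distrib-+; ∑-comm; *-distribˡ-sum)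

true≢false : true ≢ false
true≢false ()

xor≡false⇒≡ : ∀ {a b} → a xor b ≡ false → a ≡ b
xor≡false⇒≡ {true}  {true}  _ = refl
xor≡false⇒≡ {false} {false} _ = refl

∨-disjoint : ∀ {a b} → a ∧ b ≡ false → a ∨ b ≡ a xor b
∨-disjoint {true}  {false} _ = refl
∨-disjoint {false} {b}     _ = refl

∧-true : ∀ {a b} → a ∧ b ≡ true → a ≡ true × b ≡ true
∧-true {true} ab = refl , ab

xor-true⇒ : ∀ {a b} → a ≡ true → a xor b ≡ true → b ≡ false
xor-true⇒ {b = false} _ _ = refl
xor-true⇒ {b = true} refl ()

crossing-pairs : ∀ {a b c d} → a xor b ≡ true → c xor d ≡ true → (c ≡ a × d ≡ b) ⊎ (c ≡ b × d ≡ a)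
crossing-pairs {true}  {false} {true}  {false} _ _ = inj₁ (refl , refl)
crossing-pairs {true}  {false} {false} {true}  _ _ = inj₂ (refl , refl)
crossing-pairs {false} {true}  {true}  {false} _ _ = inj₂ (refl , refl)
crossing-pairs {false} {true}  {false} {true}  _ _ = inj₁ (refl , refl)

xor-telescope : ∀ a b c → (a xor b) xor (b xor c) ≡ a xor c
xor-telescope a b c = begin
  (a xor b) xor (b xor c)   ≡⟨ xor-assoc a b (b xor c) ⟩
  a xor (b xor (b xor c))   ≡⟨ cong (a xor_) (sym (xor-assoc b b c)) ⟩
  a xor ((b xor b) xor c)   ≡⟨ cong (λ x → a xor (x xor c)) (xor-same b) ⟩
  a xor c                   ∎
  where open ≡-Reasoning

sum-zero : ∀ {k} (f : Fin k → Bool) → (∀ i → f i ≡ false) → sum f ≡ false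
sum-zero {k} f f≡0 = trans (sum-cong-≗ f≡0) (sum-replicate-zero k)

sum-single : ∀ {k} (f : Fin k → Bool) i → (∀ j → j ≢ i → f j ≡ false) → sum f ≡ f i
sum-single {suc k} f i f≡0 = begin
  sum f                         ≡⟨ sum-remove {i = i} f ⟩
  f i xor sum (f ∘ punchIn i)   ≡⟨ cong (f i xor_) (sum-zero _ (λ j → f≡0 _ (punchInᵢ≢i i j))) ⟩
  f i xor false                 ≡⟨ xor-identityʳ (f i) ⟩
  f i                           ∎
  where open ≡-Reasoning

sum-witness : ∀ {k} (f : Fin k → Bool) → sum f ≡ true → ∃[ i ] f i ≡ true
sum-witness f Σf with any? (λ i → f i Bool.≟ true)
... | yes witness = witness
... | no  none    = ⊥-elim (not-¬ Σf (sum-zero f (λ i → ¬-not (λ fi → none (i , fi)))))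

parity : ℕ → Bool
parity zero    = false
parity (suc k) = not (parity k)

parity-odd : ∀ k → k % 2 ≡ 1 → parity k ≡ true
parity-odd (suc zero)    _  = refl
parity-odd (suc (suc k)) k% = trans (not-involutive (parity k)) (parity-odd k k%)

odd-parity : ∀ k → parity k ≡ true → k % 2 ≡ 1
odd-parity (suc zero)    _ = refl
odd-parity (suc (suc k)) p = odd-parity k (trans (sym (not-involutive (parity k))) p)
odd-parity zero          ()

sum-true : ∀ k → ∑[ i < k ] true ≡ parity k
sum-true zero    = refl
sum-true (suc k) = trans (true-xor _) (cong not (sum-true k))

parity-count : ∀ {k} (S : Subset k) → parity ∣ S ∣ ≡ sum (lookup S)
parity-count []          = refl
parity-count (true ∷ S)  = trans (cong not (parity-count S)) (sym (true-xor _))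
parity-count (false ∷ S) = parity-count S

_≡ᵇ_ : ∀ {k} → Fin k → Fin k → Bool
i ≡ᵇ j = does (i ≟ j)

≡ᵇ-refl : ∀ {k} (i : Fin k) → i ≡ᵇ i ≡ true
≡ᵇ-refl i = dec-true (i ≟ i) refl

≢⇒≡ᵇ-false : ∀ {k} {i j : Fin k} → i ≢ j → i ≡ᵇ j ≡ false
≢⇒≡ᵇ-false {i = i} {j} = dec-false (i ≟ j)

≡ᵇ⇒≡ : ∀ {k} {i j : Fin k} → i ≡ᵇ j ≡ true → i ≡ j
≡ᵇ⇒≡ {i = i} {j} eq with i ≟ j
... | yes i≡j = i≡j

sum-≡ᵇ : ∀ {k} (i : Fin k) → ∑[ j < k ] (i ≡ᵇ j) ≡ true
sum-≡ᵇ i = trans (sum-single _ i (λ j j≢i → ≢⇒≡ᵇ-false (j≢i ∘ sym))) (≡ᵇ-refl i)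

≡ᵇ-∧-≢ : ∀ {k} {u v : Fin k} → u ≢ v → ∀ w → (w ≡ᵇ u) ∧ (w ≡ᵇ v) ≡ false
≡ᵇ-∧-≢ {u = u} u≢v w with w ≟ u
... | yes refl = ≢⇒≡ᵇ-false u≢v
... | no  _    = refl

sum-≡ᵇ′ : ∀ {k} (i : Fin k) → ∑[ j < k ] (j ≡ᵇ i) ≡ true
sum-≡ᵇ′ i = trans (sum-single _ i (λ j j≢i → ≢⇒≡ᵇ-false j≢i)) (≡ᵇ-refl i)

infix 7 _·_

_·_ : ∀ {m} → (Fin m → Bool) → (Fin m → Bool) → Bool
A · B = sum (λ e → A e ∧ B e)

·-cong : ∀ {m} {A A′ B B′ : Fin m → Bool} → A ≗ A′ → B ≗ B′ → A · B ≡ A′ · B′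
·-cong A≗A′ B≗B′ = sum-cong-≗ (λ e → cong₂ _∧_ (A≗A′ e) (B≗B′ e))

·-comm : ∀ {m} (A B : Fin m → Bool) → A · B ≡ B · A
·-comm A B = sum-cong-≗ (λ e → ∧-comm (A e) (B e))

·-distribʳ-xor : ∀ {m} (A B C : Fin m → Bool) → (λ e → A e xor B e) · C ≡ A · C xor B · C
·-distribʳ-xor A B C =
  trans (sum-cong-≗ (λ e → ∧-distribʳ-xor (C e) (A e) (B e)))
        (∑-distrib-+ (λ e → A e ∧ C e) (λ e → B e ∧ C e))

·-distribˡ-xor : ∀ {m} (A B C : Fin m → Bool) → A · (λ e → B e xor C e) ≡ A · B xor A · C
·-distribˡ-xor A B C =
  trans (sum-cong-≗ (λ e → ∧-distribˡ-xor (A e) (B e) (C e)))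
        (∑-distrib-+ (λ e → A e ∧ B e) (λ e → A e ∧ C e))

·-scaleˡ : ∀ {m} c (A B : Fin m → Bool) → (λ e → c ∧ A e) · B ≡ c ∧ A · B
·-scaleˡ c A B =
  trans (sum-cong-≗ (λ e → ∧-assoc c (A e) (B e))) (sym (*-distribˡ-sum c (λ e → A e ∧ B e)))

·-single : ∀ {m} (A B : Fin m → Bool) e₀ → A e₀ ≡ true → B e₀ ≡ true →
           (∀ e → A e ∧ B e ≡ true → e ≡ e₀) → A · B ≡ true
·-single A B e₀ Ae₀ Be₀ unique = trans (sum-single _ e₀ vanish) (cong₂ _∧_ Ae₀ Be₀)
  where
  vanish : ∀ e → e ≢ e₀ → A e ∧ B e ≡ false
  vanish e e≢e₀ with A e ∧ B e in AB
  ... | true  = ⊥-elim (e≢e₀ (unique e AB))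
  ... | false = refl

·-disjoint : ∀ {m} (A B : Fin m → Bool) → (∀ e → A e ∧ B e ≡ false) → A · B ≡ false
·-disjoint A B = sum-zero _

·-indicator : ∀ {m} (e : Fin m) (B : Fin m → Bool) → (_≡ᵇ e) · B ≡ B e
·-indicator e B = trans (sum-single _ e (λ g g≢e → cong (_∧ B g) (≢⇒≡ᵇ-false g≢e)))
                        (cong (_∧ B e) (≡ᵇ-refl e))

·-punchIn : ∀ {m} (e : Fin (suc m)) (A B : Fin (suc m) → Bool) →
            A · B ≡ (A e ∧ B e) xor (A ∘ punchIn e) · (B ∘ punchIn e)
·-punchIn e A B = sum-remove {i = e} (λ g → A g ∧ B g)

double-counting : ∀ {k m} (P : Fin k → Bool) (J : Fin m → Bool) (C : Fin k → Fin m → Bool) →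
                  ∑[ i < k ] (P i ∧ J · C i) ≡ J · (λ e → ∑[ i < k ] (P i ∧ C i e))
double-counting {k} {m} P J C = begin
  ∑[ i < k ] (P i ∧ J · C i)                    ≡⟨ sum-cong-≗ (λ i → *-distribˡ-sum (P i) (λ e → J e ∧ C i e)) ⟩
  ∑[ i < k ] ∑[ e < m ] (P i ∧ (J e ∧ C i e))   ≡⟨ ∑-comm (λ i e → P i ∧ (J e ∧ C i e)) ⟩
  ∑[ e < m ] ∑[ i < k ] (P i ∧ (J e ∧ C i e))   ≡⟨ sum-cong-≗ (λ e → sum-cong-≗ (λ i → ∧-swap (P i) (J e) (C i e))) ⟩
  ∑[ e < m ] ∑[ i < k ] (J e ∧ (P i ∧ C i e))   ≡⟨ sum-cong-≗ (λ e → sym (*-distribˡ-sum (J e) (λ i → P i ∧ C i e))) ⟩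
  J · (λ e → ∑[ i < k ] (P i ∧ C i e))          ∎
  where
  open ≡-Reasoning
  ∧-swap : ∀ a b c → a ∧ (b ∧ c) ≡ b ∧ (a ∧ c)
  ∧-swap a b c = trans (sym (∧-assoc a b c)) (trans (cong (_∧ c) (∧-comm a b)) (∧-assoc b a c))

infix 4 _⊆ᵇ_
_⊆ᵇ_ : ∀ {m} → (Fin m → Bool) → (Fin m → Bool) → Set
A ⊆ᵇ B = ∀ e → A e ≡ true → B e ≡ true

⊆ᵇ-false : ∀ {m} {A B : Fin m → Bool} → A ⊆ᵇ B → ∀ e → B e ≡ false → A e ≡ false
⊆ᵇ-false {A = A} A⊆B e Be with A e in Ae
... | true  = ⊥-elim (true≢false (trans (sym (A⊆B e Ae)) Be))
... | false = refl

module _ {n m : ℕ} (D : Digraph n m) where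

  crosses : (Fin n → Bool) → Fin m → Bool
  crosses X e = X (src D e) xor X (tgt D e)

  HasCrossingEdge : (Fin n → Bool) → Set
  HasCrossingEdge X = ∃[ e ] crosses X e ≡ true

  IsBondᵇ : (Fin n → Bool) → Set
  IsBondᵇ X = HasCrossingEdge X ×
              (∀ Y → HasCrossingEdge Y → crosses Y ⊆ᵇ crosses X → crosses X ⊆ᵇ crosses Y)

  IsDirectedᵇ : (Fin n → Bool) → Set
  IsDirectedᵇ X = ∀ e → crosses X e ≡ true → X (src D e) ≡ true

  IsDirectedBond : (Fin n → Bool) → Set
  IsDirectedBond X = IsBondᵇ X × IsDirectedᵇ X

  IsOddDijoinᵇ : (Fin m → Bool) → Set
  IsOddDijoinᵇ J = ∀ X → IsDirectedBond X → J · crosses X ≡ true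

  HasOddDijoinᵇ : Set
  HasOddDijoinᵇ = ∃ IsOddDijoinᵇ

  IsContractionDijoin : Fin m → (Fin m → Bool) → Set
  IsContractionDijoin e J = ∀ X → IsDirectedBond X → crosses X e ≡ false → J · crosses X ≡ true

  crosses-cong : ∀ {X X′} → X ≗ X′ → crosses X ≗ crosses X′
  crosses-cong X≗X′ e = cong₂ _xor_ (X≗X′ (src D e)) (X≗X′ (tgt D e))

  isBondᵇ-resp : ∀ X X′ → crosses X ≗ crosses X′ → IsBondᵇ X → IsBondᵇ X′
  isBondᵇ-resp X X′ X≗X′ ((e , Xe) , minimal) =
    (e , trans (sym (X≗X′ e)) Xe) ,
    λ Y neY Y⊆X′ f X′f → minimal Y neY (λ g Yg → trans (X≗X′ g) (Y⊆X′ g Yg)) f (trans (X≗X′ f) X′f)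

  isDirectedᵇ-resp : ∀ X X′ → X ≗ X′ → IsDirectedᵇ X → IsDirectedᵇ X′
  isDirectedᵇ-resp X X′ X≗X′ dir e X′e =
    trans (sym (X≗X′ (src D e))) (dir e (trans (crosses-cong {X} {X′} X≗X′ e) X′e))

  bond-cuts-≗ : ∀ X Y → IsBondᵇ X → HasCrossingEdge Y → crosses Y ⊆ᵇ crosses X → crosses X ≗ crosses Y
  bond-cuts-≗ X Y (_ , minimal) neY Y⊆X e = ⇔→≡ (mk⇔ (minimal Y neY Y⊆X e) (Y⊆X e))

  uncrossed : ∀ X Y → crosses Y ⊆ᵇ crosses X → ∀ e → crosses X e ≡ false → Y (src D e) ≡ Y (tgt D e)
  uncrossed X Y Y⊆X e Xe = xor≡false⇒≡ (⊆ᵇ-false Y⊆X e Xe)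

  ConstantOnSides : (X Y : Fin n → Bool) → Set
  ConstantOnSides X Y = ∀ u v → X u ≡ X v → Y u ≡ Y v

  -- the cut-level form of "if both sides of X are connected, then X is a bond"
  bond-if-sides-rigid : ∀ {X} → HasCrossingEdge X →
                        (∀ Y → crosses Y ⊆ᵇ crosses X → ConstantOnSides X Y) → IsBondᵇ X
  bond-if-sides-rigid {X} neX rigid = neX , minimal
    where
    minimal : ∀ Y → HasCrossingEdge Y → crosses Y ⊆ᵇ crosses X → crosses X ⊆ᵇ crosses Y
    minimal Y (g , Yg) Y⊆X e Xe with rigid Y Y⊆X | crossing-pairs (Y⊆X g Yg) Xe
    ... | const | inj₁ (s , t) = trans (cong₂ _xor_ (const _ _ s) (const _ _ t)) Yg
    ... | const | inj₂ (s , t) =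
      trans (cong₂ _xor_ (const _ _ s) (const _ _ t)) (trans (xor-comm (Y (tgt D g)) (Y (src D g))) Yg)

  lookup-cut : ∀ S e → lookup (cut D S) e ≡ crosses (lookup S) e
  lookup-cut S = lookup∘tabulate _

  ∈cut⇒ : ∀ S {e} → e ∈ cut D S → crosses (lookup S) e ≡ true
  ∈cut⇒ S {e} e∈ = trans (sym (lookup-cut S e)) ([]=⇒lookup e∈)

  ⇒∈cut : ∀ S {e} → crosses (lookup S) e ≡ true → e ∈ cut D S
  ⇒∈cut S {e} Se = lookup⇒[]= e (cut D S) (trans (lookup-cut S e) Se)

  isBond⇒ : ∀ S → IsBond D S → IsBondᵇ (lookup S)
  isBond⇒ S ((e , e∈) , minimal) = (e , ∈cut⇒ S e∈) , minimalᵇ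
    where
    minimalᵇ : ∀ Y → HasCrossingEdge Y → crosses Y ⊆ᵇ crosses (lookup S) → crosses (lookup S) ⊆ᵇ crosses Y
    minimalᵇ Y (f , Yf) Y⊆S g Sg =
      trans (sym (T≗Y g)) (∈cut⇒ T (minimal T (f , ⇒∈cut T (trans (T≗Y f) Yf)) T⊆S (⇒∈cut S Sg)))
      where
      T = tabulate Y
      T≗Y : crosses (lookup T) ≗ crosses Y
      T≗Y = crosses-cong {lookup T} (lookup∘tabulate Y)
      T⊆S : cut D T ⊆ cut D S
      T⊆S {h} h∈ = ⇒∈cut S (Y⊆S h (trans (sym (T≗Y h)) (∈cut⇒ T h∈)))

  ⇒isBond : ∀ S → IsBondᵇ (lookup S) → IsBond D S
  ⇒isBond S ((e , Se) , minimal) =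
    (e , ⇒∈cut S Se) ,
    λ T (f , f∈) T⊆S g∈ →
      ⇒∈cut T (minimal (lookup T) (f , ∈cut⇒ T f∈) (λ h Th → ∈cut⇒ S (T⊆S (⇒∈cut T Th)))
                       _ (∈cut⇒ S g∈))

  isDirectedCut⇒ : ∀ S → IsDirectedCut D S → IsDirectedᵇ (lookup S)
  isDirectedCut⇒ S dir e Se = []=⇒lookup (dir e (⇒∈cut S Se))

  ⇒isDirectedCut : ∀ S → IsDirectedᵇ (lookup S) → IsDirectedCut D S
  ⇒isDirectedCut S dir e e∈ = lookup⇒[]= _ S (dir e (∈cut⇒ S e∈))

  parity-∩-cut : ∀ J S → parity ∣ J ∩ cut D S ∣ ≡ lookup J · crosses (lookup S)
  parity-∩-cut J S = trans (parity-count (J ∩ cut D S))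
    (sum-cong-≗ (λ e → trans (lookup-zipWith _∧_ e J (cut D S)) (cong (lookup J e ∧_) (lookup-cut S e))))

  hasOddDijoin⇒ : HasOddDijoin D → HasOddDijoinᵇ
  hasOddDijoin⇒ (J , odd) = lookup J , oddᵇ
    where
    oddᵇ : IsOddDijoinᵇ (lookup J)
    oddᵇ X (bond , dir) = begin
      lookup J · crosses X            ≡⟨ ·-cong (λ _ → refl) (crosses-cong {X} X≗S) ⟩
      lookup J · crosses (lookup S)   ≡⟨ parity-∩-cut J S ⟨
      parity ∣ J ∩ cut D S ∣          ≡⟨ parity-odd ∣ J ∩ cut D S ∣ (odd S bondS dirS) ⟩
      true                            ∎
      where
      open ≡-Reasoning
      S = tabulate X
      X≗S : X ≗ lookup S
      X≗S u = sym (lookup∘tabulate X u)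
      bondS = ⇒isBond S (isBondᵇ-resp X (lookup S) (crosses-cong {X} X≗S) bond)
      dirS  = ⇒isDirectedCut S (isDirectedᵇ-resp X (lookup S) X≗S dir)

  ⇒hasOddDijoin : HasOddDijoinᵇ → HasOddDijoin D
  ⇒hasOddDijoin (J , odd) = tabulate J , λ S bond dir → odd-parity ∣ tabulate J ∩ cut D S ∣ (begin
    parity ∣ tabulate J ∩ cut D S ∣            ≡⟨ parity-∩-cut (tabulate J) S ⟩
    lookup (tabulate J) · crosses (lookup S)   ≡⟨ ·-cong (lookup∘tabulate J) (λ _ → refl) ⟩
    J · crosses (lookup S)                     ≡⟨ odd (lookup S) (isBond⇒ S bond , isDirectedCut⇒ S dir) ⟩
    true                                       ∎)
    where open ≡-Reasoning

-- Cut-minor steps preserve odd dijoins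

∀-punchIn : ∀ {m} {P : Fin (suc m) → Set} (e : Fin (suc m)) → P e → (∀ f → P (punchIn e f)) → ∀ g → P g
∀-punchIn {P = P} e Pe Pf g with e ≟ g
... | yes refl = Pe
... | no  e≢g  = subst P (punchIn-punchOut e≢g) (Pf (punchOut e≢g))

module _ {n m : ℕ} (D : Digraph n m) where

  walkParity : ∀ {u v} → Path D u v → Fin m → Bool
  walkParity here        _ = false
  walkParity (there f p) g = (g ≡ᵇ f) xor walkParity p g

  walkParity-·-crosses : ∀ {u v} (p : Path D u v) X → walkParity p · crosses D X ≡ X u xor X v
  walkParity-·-crosses {u} here X = trans (sum-zero {m} _ (λ _ → refl)) (sym (xor-same (X u)))
  walkParity-·-crosses {v = v} (there f p) X = begin
    walkParity (there f p) · crosses D X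
      ≡⟨ ·-distribʳ-xor (_≡ᵇ f) (walkParity p) (crosses D X) ⟩
    (_≡ᵇ f) · crosses D X xor walkParity p · crosses D X
      ≡⟨ cong₂ _xor_ (·-indicator f (crosses D X)) (walkParity-·-crosses p X) ⟩
    (X (src D f) xor X (tgt D f)) xor (X (tgt D f) xor X v)
      ≡⟨ xor-telescope (X (src D f)) (X (tgt D f)) (X v) ⟩
    X (src D f) xor X v
      ∎
    where open ≡-Reasoning

  walk-enters : ∀ {u v} → Path D u v → ∀ X → X u ≡ false → X v ≡ true →
                ∃[ f ] (crosses D X f ≡ true × X (src D f) ≡ false)
  walk-enters here X Xu Xv = ⊥-elim (not-¬ Xu Xv)
  walk-enters (there f p) X Xu Xv with X (tgt D f) in Xt
  ... | false = walk-enters p X Xt Xv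
  ... | true  = f , cong₂ _xor_ Xu Xt , Xu

module EdgeDeletion {n m : ℕ} (D : Digraph n (suc m)) (e : Fin (suc m))
                    (p : Path (DeleteEdge D e) (src D e) (tgt D e)) where

  private
    D′ = DeleteEdge D e

  crosses-deleted : ∀ X → crosses D X e ≡ walkParity D′ p · crosses D′ X
  crosses-deleted X = sym (walkParity-·-crosses D′ p X)

  crosses-≗ : ∀ X Y → crosses D′ X ≗ crosses D′ Y → crosses D X ≗ crosses D Y
  crosses-≗ X Y X≗Y = ∀-punchIn e
    (begin
      crosses D X e                    ≡⟨ crosses-deleted X ⟩
      walkParity D′ p · crosses D′ X   ≡⟨ ·-cong (λ _ → refl) X≗Y ⟩
      walkParity D′ p · crosses D′ Y   ≡⟨ crosses-deleted Y ⟨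
      crosses D Y e                    ∎)
    X≗Y
    where open ≡-Reasoning

  isBond-lift : ∀ X → IsBondᵇ D′ X → IsBondᵇ D X
  isBond-lift X bond@((f , Xf) , _) = (punchIn e f , Xf) , minimal
    where
    minimal : ∀ Y → HasCrossingEdge D Y → crosses D Y ⊆ᵇ crosses D X → crosses D X ⊆ᵇ crosses D Y
    minimal Y (g , Yg) Y⊆X h Xh =
      trans (sym (crosses-≗ X Y (bond-cuts-≗ D′ X Y bond neY′ (Y⊆X ∘ punchIn e)) h)) Xh
      where
      neY′ : HasCrossingEdge D′ Y
      neY′ = ∀-punchIn {P = λ g → crosses D Y g ≡ true → HasCrossingEdge D′ Y} e
        (λ Ye → let (f , wf) = sum-witness _ (trans (sym (crosses-deleted Y)) Ye)
                in f , proj₂ (∧-true wf))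
        (λ f Yf → f , Yf) g Yg

  isDirected-lift : ∀ X → IsDirectedᵇ D′ X → IsDirectedᵇ D X
  isDirected-lift X dir = ∀-punchIn e at-e dir
    where
    at-e : crosses D X e ≡ true → X (src D e) ≡ true
    at-e Xe with X (src D e) in Xs
    ... | true  = refl
    ... | false = let (f , Xf , Xsf) = walk-enters D′ p X Xs Xe in ⊥-elim (not-¬ Xsf (dir f Xf))

  hasOddDijoin : HasOddDijoinᵇ D → HasOddDijoinᵇ D′
  hasOddDijoin (J , odd) = J′ , λ X (bond , dir) →
    trans (J′-· X) (odd X (isBond-lift X bond , isDirected-lift X dir))
    where
    -- the weight of e is rerouted along the parallel walk
    J′ : Fin m → Bool
    J′ f = J (punchIn e f) xor (J e ∧ walkParity D′ p f)

    J′-· : ∀ X → J′ · crosses D′ X ≡ J · crosses D X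
    J′-· X = begin
      J′ · crosses D′ X
        ≡⟨ ·-distribʳ-xor (J ∘ punchIn e) (λ f → J e ∧ walkParity D′ p f) (crosses D′ X) ⟩
      (J ∘ punchIn e) · crosses D′ X xor (λ f → J e ∧ walkParity D′ p f) · crosses D′ X
        ≡⟨ cong ((J ∘ punchIn e) · crosses D′ X xor_) (·-scaleˡ (J e) (walkParity D′ p) (crosses D′ X)) ⟩
      (J ∘ punchIn e) · crosses D′ X xor (J e ∧ walkParity D′ p · crosses D′ X)
        ≡⟨ cong (λ c → (J ∘ punchIn e) · crosses D′ X xor (J e ∧ c)) (crosses-deleted X) ⟨
      (J ∘ punchIn e) · crosses D′ X xor (J e ∧ crosses D X e)
        ≡⟨ xor-comm ((J ∘ punchIn e) · crosses D′ X) (J e ∧ crosses D X e) ⟩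
      (J e ∧ crosses D X e) xor (J ∘ punchIn e) · crosses D′ X
        ≡⟨ ·-punchIn e J (crosses D X) ⟨
      J · crosses D X
        ∎
      where open ≡-Reasoning

module VertexDeletion {n m : ℕ} (D : Digraph (suc n) m) (v : Fin (suc n)) (D′ : Digraph n m)
                      (src≡ : ∀ f → src D f ≡ punchIn v (src D′ f))
                      (tgt≡ : ∀ f → tgt D f ≡ punchIn v (tgt D′ f)) where

  crosses-restrict : ∀ Y → crosses D Y ≗ crosses D′ (Y ∘ punchIn v)
  crosses-restrict Y f = cong₂ _xor_ (cong Y (src≡ f)) (cong Y (tgt≡ f))

  extend : (Fin n → Bool) → Fin (suc n) → Bool
  extend X u with v ≟ u
  ... | yes _   = false
  ... | no  v≢u = X (punchOut v≢u)

  extend-punchIn : ∀ X w → extend X (punchIn v w) ≡ X w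
  extend-punchIn X w with v ≟ punchIn v w
  ... | yes v≡ = ⊥-elim (punchInᵢ≢i v w (sym v≡))
  ... | no  _  = cong X (trans (punchOut-cong v refl) (punchOut-punchIn v))

  crosses-extend : ∀ X → crosses D (extend X) ≗ crosses D′ X
  crosses-extend X f =
    trans (crosses-restrict (extend X) f) (crosses-cong D′ {extend X ∘ punchIn v} (extend-punchIn X) f)

  isDirectedBond-extend : ∀ X → IsDirectedBond D′ X → IsDirectedBond D (extend X)
  isDirectedBond-extend X (((f , Xf) , minimal) , dir) =
    ((f , trans (crosses-extend X f) Xf) , minimalᵉ) ,
    λ g Xg → trans (cong (extend X) (src≡ g))
                   (trans (extend-punchIn X _) (dir g (trans (sym (crosses-extend X g)) Xg)))
    where
    minimalᵉ : ∀ Y → HasCrossingEdge D Y → crosses D Y ⊆ᵇ crosses D (extend X) →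
               crosses D (extend X) ⊆ᵇ crosses D Y
    minimalᵉ Y (g , Yg) Y⊆X h Xh = trans (crosses-restrict Y h) (minimal (Y ∘ punchIn v)
      (g , trans (sym (crosses-restrict Y g)) Yg)
      (λ k Yk → trans (sym (crosses-extend X k)) (Y⊆X k (trans (crosses-restrict Y k) Yk)))
      h (trans (sym (crosses-extend X h)) Xh))

  hasOddDijoin : HasOddDijoinᵇ D → HasOddDijoinᵇ D′
  hasOddDijoin (J , odd) = J , λ X db →
    trans (·-cong (λ _ → refl) (λ f → sym (crosses-extend X f))) (odd (extend X) (isDirectedBond-extend X db))

module EdgeContraction {n m : ℕ} (D : Digraph (suc n) (suc m)) (e : Fin (suc m))
    (D′ : Digraph n m) (q : Fin (suc n) → Fin n)
    (q-identifies : q (src D e) ≡ q (tgt D e))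
    (q-fibres : ∀ u v → q u ≡ q v → u ≡ v ⊎ ((u ≡ src D e × v ≡ tgt D e) ⊎ (u ≡ tgt D e × v ≡ src D e)))
    (src≡ : ∀ f → src D′ f ≡ q (src D (punchIn e f)))
    (tgt≡ : ∀ f → tgt D′ f ≡ q (tgt D (punchIn e f))) where

  crosses-pullback : ∀ X f → crosses D (X ∘ q) (punchIn e f) ≡ crosses D′ X f
  crosses-pullback X f = sym (cong₂ _xor_ (cong X (src≡ f)) (cong X (tgt≡ f)))

  pullback-uncrossed : ∀ X → crosses D (X ∘ q) e ≡ false
  pullback-uncrossed X = trans (cong (X (q (src D e)) xor_) (cong X (sym q-identifies))) (xor-same (X (q (src D e))))

  descend : ∀ Y → crosses D Y e ≡ false → ∃[ Y′ ] Y′ ∘ q ≗ Y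
  descend Y Ye = Y′ , Y′∘q
    where
    constant-on-fibres : ∀ u v → q u ≡ q v → Y u ≡ Y v
    constant-on-fibres u v quv with q-fibres u v quv
    ... | inj₁ refl                  = refl
    ... | inj₂ (inj₁ (refl , refl)) = xor≡false⇒≡ Ye
    ... | inj₂ (inj₂ (refl , refl)) = sym (xor≡false⇒≡ Ye)

    meets-fibre? : ∀ w → Dec (∃[ u ] (q u ≡ w × Y u ≡ true))
    meets-fibre? w = any? (λ u → (q u ≟ w) ×-dec (Y u Bool.≟ true))

    -- q need not be onto; off its image Y′ is false
    Y′ : Fin n → Bool
    Y′ w = does (meets-fibre? w)

    value-on-fibre : ∀ {w} (d : Dec (∃[ u ] (q u ≡ w × Y u ≡ true))) → ∀ u → q u ≡ w → does d ≡ Y u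
    value-on-fibre (yes (u′ , qu′ , Yu′)) u qu = trans (sym Yu′) (constant-on-fibres u′ u (trans qu′ (sym qu)))
    value-on-fibre (no  none)             u qu = sym (¬-not (λ Yu → none (u , qu , Yu)))

    Y′∘q : ∀ u → Y′ (q u) ≡ Y u
    Y′∘q u = value-on-fibre (meets-fibre? (q u)) u refl

  isBond-pullback : ∀ X → IsBondᵇ D′ X → IsBondᵇ D (X ∘ q)
  isBond-pullback X ((f , Xf) , minimal′) = (punchIn e f , trans (crosses-pullback X f) Xf) , minimal
    where
    minimal : ∀ Y → HasCrossingEdge D Y → crosses D Y ⊆ᵇ crosses D (X ∘ q) →
              crosses D (X ∘ q) ⊆ᵇ crosses D Y
    minimal Y (g , Yg) Y⊆X = ∀-punchIn e
      (λ Xe → ⊥-elim (true≢false (trans (sym Xe) (pullback-uncrossed X))))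
      (λ h Xh → trans (sym (Y′≗Y h)) (minimal′ Y′ neY′ Y′⊆X h (trans (sym (crosses-pullback X h)) Xh)))
      where
      Ye : crosses D Y e ≡ false
      Ye = ⊆ᵇ-false Y⊆X e (pullback-uncrossed X)
      Y′ = proj₁ (descend Y Ye)
      Y′≗Y : ∀ h → crosses D′ Y′ h ≡ crosses D Y (punchIn e h)
      Y′≗Y h = trans (sym (crosses-pullback Y′ h)) (crosses-cong D {Y′ ∘ q} (proj₂ (descend Y Ye)) (punchIn e h))
      neY′ : HasCrossingEdge D′ Y′
      neY′ = ∀-punchIn {P = λ g → crosses D Y g ≡ true → HasCrossingEdge D′ Y′} e
        (λ Ye′ → ⊥-elim (true≢false (trans (sym Ye′) Ye)))
        (λ h Yh → h , trans (Y′≗Y h) Yh) g Yg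
      Y′⊆X : crosses D′ Y′ ⊆ᵇ crosses D′ X
      Y′⊆X h Y′h = trans (sym (crosses-pullback X h)) (Y⊆X _ (trans (sym (Y′≗Y h)) Y′h))

  isDirected-pullback : ∀ X → IsDirectedᵇ D′ X → IsDirectedᵇ D (X ∘ q)
  isDirected-pullback X dir = ∀-punchIn e
    (λ Xe → ⊥-elim (true≢false (trans (sym Xe) (pullback-uncrossed X))))
    (λ f Xf → trans (sym (cong X (src≡ f))) (dir f (trans (sym (crosses-pullback X f)) Xf)))

  ·-pullback : ∀ J X → J · crosses D (X ∘ q) ≡ (J ∘ punchIn e) · crosses D′ X
  ·-pullback J X = begin
    J · crosses D (X ∘ q)
      ≡⟨ ·-punchIn e J (crosses D (X ∘ q)) ⟩
    (J e ∧ crosses D (X ∘ q) e) xor (J ∘ punchIn e) · (crosses D (X ∘ q) ∘ punchIn e)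
      ≡⟨ cong₂ _xor_ (trans (cong (J e ∧_) (pullback-uncrossed X)) (∧-zeroʳ (J e)))
                     (·-cong (λ _ → refl) (crosses-pullback X)) ⟩
    false xor (J ∘ punchIn e) · crosses D′ X
      ∎
    where open ≡-Reasoning

  hasOddDijoin : ∀ J → IsContractionDijoin D e J → HasOddDijoinᵇ D′
  hasOddDijoin J odd = J ∘ punchIn e , λ X (bond , dir) →
    trans (sym (·-pullback J X))
          (odd (X ∘ q) (isBond-pullback X bond , isDirected-pullback X dir) (pullback-uncrossed X))

step-hasOddDijoin : ∀ {n m n′ m′} {D : Digraph n m} {D′ : Digraph n′ m′} →
                    Step D D′ → HasOddDijoinᵇ D → HasOddDijoinᵇ D′
step-hasOddDijoin (delete D e _ p)        = EdgeDeletion.hasOddDijoin D e p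
step-hasOddDijoin (contractLoop D e loop) =
  -- contracting a loop deletes it, and a loop is parallel to the empty walk
  EdgeDeletion.hasOddDijoin D e (subst (Path (DeleteEdge D e) (src D e)) loop here)
step-hasOddDijoin (contractEdge D e D′ q _ q-e q-fibres src≡ tgt≡) (J , odd) =
  EdgeContraction.hasOddDijoin D e D′ q q-e q-fibres src≡ tgt≡ J (λ X db _ → odd X db)
step-hasOddDijoin (deleteVertex D v D′ src≡ tgt≡) = VertexDeletion.hasOddDijoin D v D′ src≡ tgt≡

properCutMinor-hasOddDijoin : ∀ {n m n′ m′} {D : Digraph n m} {D′ : Digraph n′ m′} →
                              ProperCutMinor D D′ → HasOddDijoinᵇ D → HasOddDijoinᵇ D′
properCutMinor-hasOddDijoin [ s ]   = step-hasOddDijoin s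
properCutMinor-hasOddDijoin (s ∷ r) = properCutMinor-hasOddDijoin r ∘ step-hasOddDijoin s

-- A criterion for minimal obstructions

module _ {n m : ℕ} (D : Digraph n m) where

  IsGrading : (Fin n → ℕ) → Set
  IsGrading level = ∀ f → level (tgt D f) ≡ suc (level (src D f))

  NoParallelEdges : Set
  NoParallelEdges = ∀ e f → src D e ≡ src D f → tgt D e ≡ tgt D f → e ≡ f

  module _ (level : Fin n → ℕ) (graded : IsGrading level) where

    graded-loopless : ∀ f → src D f ≢ tgt D f
    graded-loopless f loop = 1+n≰n (≤-reflexive (trans (sym (graded f)) (cong level (sym loop))))

    walk-level : ∀ {u v} → Path D u v → level u ≤ level v
    walk-level here        = ≤-refl
    walk-level (there f p) = ≤-trans (n≤1+n _) (≤-trans (≤-reflexive (sym (graded f))) (walk-level p))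

    walk-flat : ∀ {u v} → Path D u v → level v ≤ level u → u ≡ v
    walk-flat here        _   = refl
    walk-flat (there f p) v≤u =
      ⊥-elim (1+n≰n (≤-trans (≤-reflexive (sym (graded f))) (≤-trans (walk-level p) v≤u)))

module _ {n m : ℕ} (D : Digraph n (suc m)) (level : Fin n → ℕ) (graded : IsGrading D level)
         (simple : NoParallelEdges D) where

  -- in a graded digraph a walk from the tail to the head of e has length one
  no-parallel-walk : ∀ e {u v} → Path (DeleteEdge D e) u v → u ≡ src D e → v ≡ tgt D e → ⊥
  no-parallel-walk e here        u≡s u≡t = graded-loopless D level graded e (trans (sym u≡s) u≡t)
  no-parallel-walk e (there f p) s≡s v≡t = punchInᵢ≢i e f (simple _ _ s≡s (trans tgt≡v v≡t))
    where
    tgt≡v : tgt D (punchIn e f) ≡ _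
    tgt≡v = walk-flat (DeleteEdge D e) level (graded ∘ punchIn e) p (≤-reflexive (begin
      level _                             ≡⟨ cong level v≡t ⟩
      level (tgt D e)                     ≡⟨ graded e ⟩
      suc (level (src D e))               ≡⟨ cong (suc ∘ level) s≡s ⟨
      suc (level (src D (punchIn e f)))   ≡⟨ graded (punchIn e f) ⟨
      level (tgt D (punchIn e f))         ∎))
      where open ≡-Reasoning

record Criticality {n m : ℕ} (D : Digraph n m) : Set where
  field
    level       : Fin n → ℕ
    graded      : IsGrading D level
    simple      : NoParallelEdges D
    no-isolated : ∀ v → ∃ (Incident D v)
    contraction-dijoin : ∀ e → ∃ (IsContractionDijoin D e)

first-step-hasOddDijoin : ∀ {n m n′ m′} {D : Digraph n m} {D′ : Digraph n′ m′} →
                          Criticality D → Step D D′ → HasOddDijoinᵇ D′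
first-step-hasOddDijoin crit (delete D e _ p) =
  ⊥-elim (no-parallel-walk D level graded simple e p refl refl)
  where open Criticality crit
first-step-hasOddDijoin crit (contractLoop D e loop) = ⊥-elim (graded-loopless D level graded e loop)
  where open Criticality crit
first-step-hasOddDijoin crit (contractEdge D e D′ q _ q-e q-fibres src≡ tgt≡) =
  let (J , odd) = Criticality.contraction-dijoin crit e
  in EdgeContraction.hasOddDijoin D e D′ q q-e q-fibres src≡ tgt≡ J odd
first-step-hasOddDijoin crit (deleteVertex D v D′ src≡ tgt≡) with Criticality.no-isolated crit v
... | f , inj₁ src≡v = ⊥-elim (punchInᵢ≢i v _ (trans (sym (src≡ f)) src≡v))
... | f , inj₂ tgt≡v = ⊥-elim (punchInᵢ≢i v _ (trans (sym (tgt≡ f)) tgt≡v))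

minimal-obstruction-criterion : ∀ {n m} (D : Digraph n m) → ¬ HasOddDijoinᵇ D → Criticality D →
                                IsMinimalObstruction D
minimal-obstruction-criterion D none crit =
  none ∘ hasOddDijoin⇒ D , λ D′ minor → ⇒hasOddDijoin D′ (after minor)
  where
  after : ∀ {n′ m′} {D′ : Digraph n′ m′} → ProperCutMinor D D′ → HasOddDijoinᵇ D′
  after [ s ]   = first-step-hasOddDijoin crit s
  after (s ∷ r) = properCutMinor-hasOddDijoin r (first-step-hasOddDijoin crit s)

element : ∀ {k} (S : Subset k) → 1 ≤ ∣ S ∣ → ∃[ a ] a ∈ S
element {k} S 1≤∣S∣ with nonempty? S
... | yes nonempty = nonempty
... | no  empty    =
  ⊥-elim (1+n≰n (≤-trans 1≤∣S∣ (≤-reflexive (trans (cong ∣_∣ (Empty-unique empty)) (∣⊥∣≡0 k)))))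

another-element : ∀ {k} (S : Subset k) → 2 ≤ ∣ S ∣ → ∀ a → ∃[ b ] (b ∈ S × b ≢ a)
another-element S 2≤∣S∣ a with any? (λ b → (b ∈? S) ×-dec ¬? (b ≟ a))
... | yes found = found
... | no  none  =
  ⊥-elim (1+n≰n (≤-trans 2≤∣S∣ (≤-trans (p⊆q⇒∣p∣≤∣q∣ S⊆⁅a⁆) (≤-reflexive (∣⁅x⁆∣≡1 a)))))
  where
  S⊆⁅a⁆ : S ⊆ ⁅ a ⁆
  S⊆⁅a⁆ {b} b∈S with b ≟ a
  ... | yes refl = x∈⁅x⁆ a
  ... | no  b≢a  = ⊥-elim (none (b , b∈S , b≢a))

avoid-three : ∀ {k} → 3 < k → (a b c : Fin k) → ∃[ v ] (v ≢ a × v ≢ b × v ≢ c)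
avoid-three {k} 3<k a b c with any? (λ v → ¬? (v ≟ a) ×-dec ¬? (v ≟ b) ×-dec ¬? (v ≟ c))
... | yes found = found
... | no  none  =
  let (i , j , i<j , same) = pigeonhole 3<k index
  in ⊥-elim (<⇒≢ i<j (trans (named i) (trans (cong point same) (sym (named j)))))
  where
  point : Fin 3 → Fin k
  point zero             = a
  point (suc zero)       = b
  point (suc (suc zero)) = c

  index : Fin k → Fin 3
  index v with v ≟ a | v ≟ b
  ... | yes _ | _     = zero
  ... | no  _ | yes _ = suc zero
  ... | no  _ | no  _ = suc (suc zero)

  named : ∀ v → v ≡ point (index v)
  named v with v ≟ a | v ≟ b
  ... | yes v≡a | _       = v≡a
  ... | no  _   | yes v≡b = v≡b
  ... | no  v≢a | no  v≢b with v ≟ c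
  ...   | yes v≡c = v≡c
  ...   | no  v≢c = ⊥-elim (none (v , v≢a , v≢b , v≢c))

singleton : ∀ {n} → Fin n → Fin n → Bool
singleton v u = u ≡ᵇ v

-- star true v is the complement of {v}; it is the orientation that makes the cut of a sink directed
star : ∀ {n} → Bool → Fin n → Fin n → Bool
star sink v u = (u ≡ᵇ v) xor sink

module _ {n m : ℕ} (D : Digraph n m) where

  crosses-star : ∀ sink v → crosses D (star sink v) ≗ crosses D (singleton v)
  crosses-star sink v f =
    trans (cong (((src D f ≡ᵇ v) xor sink) xor_) (xor-comm (tgt D f ≡ᵇ v) sink))
          (xor-telescope (src D f ≡ᵇ v) sink (tgt D f ≡ᵇ v))

  ∑-crosses-singleton : ∀ e → ∑[ v < n ] crosses D (singleton v) e ≡ false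
  ∑-crosses-singleton e = trans (∑-distrib-+ (src D e ≡ᵇ_) (tgt D e ≡ᵇ_))
                                (cong₂ _xor_ (sum-≡ᵇ (src D e)) (sum-≡ᵇ (tgt D e)))

  crosses-singleton-away : ∀ {v} f → src D f ≢ v → tgt D f ≢ v → crosses D (singleton v) f ≡ false
  crosses-singleton-away f src≢v tgt≢v = cong₂ _xor_ (≢⇒≡ᵇ-false src≢v) (≢⇒≡ᵇ-false tgt≢v)

  isBond-star : ∀ sink v → HasCrossingEdge D (singleton v) →
                (∀ Y → crosses D Y ⊆ᵇ crosses D (singleton v) → ∀ u w → u ≢ v → w ≢ v → Y u ≡ Y w) →
                IsBondᵇ D (star sink v)
  isBond-star sink v ne connected =
    isBondᵇ-resp D (singleton v) (star sink v) (λ f → sym (crosses-star sink v f))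
      (bond-if-sides-rigid D ne sides)
    where
    sides : ∀ Y → crosses D Y ⊆ᵇ crosses D (singleton v) → ConstantOnSides D (singleton v) Y
    sides Y Y⊆ u w same with u ≟ v | w ≟ v
    ... | yes refl | yes refl = refl
    ... | no  u≢v  | no  w≢v  = connected Y Y⊆ u w u≢v w≢v
    ... | yes _    | no  _    = ⊥-elim (true≢false same)
    ... | no  _    | yes _    = ⊥-elim (true≢false (sym same))

  isDirected-source-star : ∀ v → (∀ f → tgt D f ≢ v) → IsDirectedᵇ D (star false v)
  isDirected-source-star v no-in f vf =
    trans (cong ((src D f ≡ᵇ v) xor_) (sym (≢⇒≡ᵇ-false (no-in f)))) (trans (sym (crosses-star false v f)) vf)

  isDirected-sink-star : ∀ v → (∀ f → src D f ≢ v) → IsDirectedᵇ D (star true v)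
  isDirected-sink-star v no-out f _ = cong (_xor true) (≢⇒≡ᵇ-false (no-out f))

  odd-dijoin-counting : ∀ {k J} → IsOddDijoinᵇ D J → (P : Fin k → Bool) (X : Fin k → Fin n → Bool) →
                        (∀ i → P i ≡ true → IsDirectedBond D (X i)) →
                        sum P ≡ J · (λ e → ∑[ i < k ] (P i ∧ crosses D (X i) e))
  odd-dijoin-counting {J = J} odd P X bonds =
    trans (sum-cong-≗ absorb) (double-counting P J (λ i → crosses D (X i)))
    where
    absorb : ∀ i → P i ≡ P i ∧ J · crosses D (X i)
    absorb i with P i in Pi
    ... | true  = sym (odd (X i) (bonds i Pi))
    ... | false = refl

-- One-directions

module OneDirection {n m : ℕ} (D : Digraph n m) (A : Subset n)
    (2≤∣A∣ : 2 ≤ ∣ A ∣) (2≤∣B∣ : 2 ≤ ∣ ∁ A ∣)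
    (A→B : ∀ e → src D e ∈ A × tgt D e ∉ A)
    (complete : ∀ a b → a ∈ A → b ∉ A → ∃[ e ] (src D e ≡ a × tgt D e ≡ b))
    (simple : NoParallelEdges D) where

  src∈A : ∀ e → src D e ∈ A
  src∈A = proj₁ ∘ A→B

  tgt∉A : ∀ e → tgt D e ∉ A
  tgt∉A = proj₂ ∘ A→B

  ∈A⇒≢ : ∀ {a b} → a ∈ A → b ∉ A → a ≢ b
  ∈A⇒≢ a∈A b∉A refl = b∉A a∈A

  inA : Fin n → Bool
  inA v = does (v ∈? A)

  some-sink : ∃[ b ] b ∉ A
  some-sink = let (b , b∈∁A) = element (∁ A) (≤-trans (s≤s z≤n) 2≤∣B∣) in b , x∈∁p⇒x∉p b∈∁A

  some-source : ∃[ a ] a ∈ A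
  some-source = element A (≤-trans (s≤s z≤n) 2≤∣A∣)

  another-sink : ∀ v → ∃[ b ] (b ∉ A × b ≢ v)
  another-sink v = let (b , b∈∁A , b≢v) = another-element (∁ A) 2≤∣B∣ v in b , x∈∁p⇒x∉p b∈∁A , b≢v

  another-source : ∀ v → ∃[ a ] (a ∈ A × a ≢ v)
  another-source = another-element A 2≤∣A∣

  crosses-source : ∀ {a} → a ∈ A → ∀ f → crosses D (singleton a) f ≡ src D f ≡ᵇ a
  crosses-source a∈A f =
    trans (cong ((src D f ≡ᵇ _) xor_) (≢⇒≡ᵇ-false (∈A⇒≢ a∈A (tgt∉A f) ∘ sym))) (xor-identityʳ _)

  crosses-sink : ∀ {b} → b ∉ A → ∀ f → crosses D (singleton b) f ≡ tgt D f ≡ᵇ b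
  crosses-sink b∉A f = cong (_xor (tgt D f ≡ᵇ _)) (≢⇒≡ᵇ-false (∈A⇒≢ (src∈A f) b∉A))

  vertexCut : Fin n → Fin n → Bool
  vertexCut v = star (not (inA v)) v

  connected : ∀ v Y → crosses D Y ⊆ᵇ crosses D (singleton v) → ∀ u w → u ≢ v → w ≢ v → Y u ≡ Y w
  connected v Y Y⊆v u w u≢v w≢v = trans (to-sink u u≢v) (sym (to-sink w w≢v))
    where
    a′   = proj₁ (another-source v)
    a′∈A = proj₁ (proj₂ (another-source v))
    a′≢v = proj₂ (proj₂ (another-source v))
    b′   = proj₁ (another-sink v)
    b′∉A = proj₁ (proj₂ (another-sink v))
    b′≢v = proj₂ (proj₂ (another-sink v))

    joined : ∀ a b → a ∈ A → b ∉ A → a ≢ v → b ≢ v → Y a ≡ Y b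
    joined a b a∈A b∉A a≢v b≢v =
      let (f , s , t) = complete a b a∈A b∉A
      in subst₂ (λ x y → Y x ≡ Y y) s t
           (uncrossed D (singleton v) Y Y⊆v f
              (crosses-singleton-away D f (λ p → a≢v (trans (sym s) p)) (λ p → b≢v (trans (sym t) p))))

    to-sink : ∀ u → u ≢ v → Y u ≡ Y b′
    to-sink u u≢v with u ∈? A
    ... | yes u∈A = joined u b′ u∈A b′∉A u≢v b′≢v
    ... | no  u∉A = trans (sym (joined a′ u a′∈A u∉A a′≢v u≢v)) (joined a′ b′ a′∈A b′∉A a′≢v b′≢v)

  singleton-crossed : ∀ v → HasCrossingEdge D (singleton v)
  singleton-crossed v with v ∈? A
  ... | yes v∈A = let (f , s , _) = complete v _ v∈A (proj₂ some-sink) in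
                  f , trans (crosses-source v∈A f) (trans (cong (_≡ᵇ v) s) (≡ᵇ-refl v))
  ... | no  v∉A = let (f , _ , t) = complete _ v (proj₂ some-source) v∉A in
                  f , trans (crosses-sink v∉A f) (trans (cong (_≡ᵇ v) t) (≡ᵇ-refl v))

  vertexCut-directedBond : ∀ v → IsDirectedBond D (vertexCut v)
  vertexCut-directedBond v with v ∈? A
  ... | yes v∈A = isBond-star D false v (singleton-crossed v) (connected v) ,
                  isDirected-source-star D v (λ f → ∈A⇒≢ v∈A (tgt∉A f) ∘ sym)
  ... | no  v∉A = isBond-star D true v (singleton-crossed v) (connected v) ,
                  isDirected-sink-star D v (λ f → ∈A⇒≢ (src∈A f) v∉A)

  directed-closed : ∀ X → IsDirectedᵇ D X → ∀ a b → a ∈ A → b ∉ A → X b ≡ true → X a ≡ true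
  directed-closed X dir a b a∈A b∉A Xb with X a in Xa
  ... | true  = refl
  ... | false =
    let (f , s , t) = complete a b a∈A b∉A
        Xs          = trans (cong X s) Xa
    in ⊥-elim (true≢false (trans (sym (dir f (cong₂ _xor_ Xs (trans (cong X t) Xb)))) Xs))

  directedBond-vertexCut : ∀ X → IsDirectedBond D X → ∃[ v ] crosses D X ≗ crosses D (singleton v)
  directedBond-vertexCut X (bond@((g , Xg) , _) , dir)
    with any? (λ b → ¬? (b ∈? A) ×-dec (X b Bool.≟ true))
  ... | yes (b , b∉A , Xb) = tgt D g , bond-cuts-≗ D X (singleton (tgt D g)) bond ne sub
    where
    ne : HasCrossingEdge D (singleton (tgt D g))
    ne = g , trans (crosses-sink (tgt∉A g) g) (≡ᵇ-refl (tgt D g))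
    sub : crosses D (singleton (tgt D g)) ⊆ᵇ crosses D X
    sub f tf = cong₂ _xor_ (directed-closed X dir _ b (src∈A f) b∉A Xb)
                           (trans (cong X (≡ᵇ⇒≡ (trans (sym (crosses-sink (tgt∉A g) f)) tf)))
                                  (xor-true⇒ (dir g Xg) Xg))
  ... | no  none = src D g , bond-cuts-≗ D X (singleton (src D g)) bond ne sub
    where
    ne : HasCrossingEdge D (singleton (src D g))
    ne = g , trans (crosses-source (src∈A g) g) (≡ᵇ-refl (src D g))
    sub : crosses D (singleton (src D g)) ⊆ᵇ crosses D X
    sub f sf = cong₂ _xor_ (trans (cong X (≡ᵇ⇒≡ (trans (sym (crosses-source (src∈A g) f)) sf))) (dir g Xg))
                           (¬-not (λ Xt → none (tgt D f , tgt∉A f , Xt)))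

  ·-edge : ∀ a b → a ∈ A → b ∉ A → (λ f → src D f ≡ᵇ a) · (λ f → tgt D f ≡ᵇ b) ≡ true
  ·-edge a b a∈A b∉A = ·-single (λ f → src D f ≡ᵇ a) (λ f → tgt D f ≡ᵇ b) e₀
    (trans (cong (_≡ᵇ a) s) (≡ᵇ-refl a)) (trans (cong (_≡ᵇ b) t) (≡ᵇ-refl b)) unique
    where
    e₀ = proj₁ (complete a b a∈A b∉A)
    s = proj₁ (proj₂ (complete a b a∈A b∉A))
    t = proj₂ (proj₂ (complete a b a∈A b∉A))
    unique : ∀ f → (src D f ≡ᵇ a) ∧ (tgt D f ≡ᵇ b) ≡ true → f ≡ e₀
    unique f ends = let (sf , tf) = ∧-true ends in
      simple f e₀ (trans (≡ᵇ⇒≡ sf) (sym s)) (trans (≡ᵇ⇒≡ tf) (sym t))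

  ·-vertexCuts : ∀ {u v} → u ≢ v → crosses D (singleton u) · crosses D (singleton v) ≡ inA u xor inA v
  ·-vertexCuts {u} {v} u≢v with u ∈? A | v ∈? A
  ... | yes u∈A | yes v∈A = trans (·-cong (crosses-source u∈A) (crosses-source v∈A))
                                  (·-disjoint (λ f → src D f ≡ᵇ u) (λ f → src D f ≡ᵇ v) (λ f → ≡ᵇ-∧-≢ u≢v (src D f)))
  ... | no  u∉A | no  v∉A = trans (·-cong (crosses-sink u∉A) (crosses-sink v∉A))
                                  (·-disjoint (λ f → tgt D f ≡ᵇ u) (λ f → tgt D f ≡ᵇ v) (λ f → ≡ᵇ-∧-≢ u≢v (tgt D f)))
  ... | yes u∈A | no  v∉A = trans (·-cong (crosses-source u∈A) (crosses-sink v∉A)) (·-edge u v u∈A v∉A)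
  ... | no  u∉A | yes v∈A = trans (·-cong (crosses-sink u∉A) (crosses-source v∈A))
                                  (trans (·-comm (λ f → tgt D f ≡ᵇ u) (λ f → src D f ≡ᵇ v)) (·-edge v u v∈A u∉A))

  -- every edge lies in exactly two vertex stars, so the n odd intersections add up to an even number
  no-odd-dijoin : Odd n → ¬ HasOddDijoinᵇ D
  no-odd-dijoin odd-n (J , odd) = true≢false (begin
    true
      ≡⟨ parity-odd n odd-n ⟨
    parity n
      ≡⟨ sum-true n ⟨
    ∑[ v < n ] true
      ≡⟨ odd-dijoin-counting D odd (λ _ → true) vertexCut (λ v _ → vertexCut-directedBond v) ⟩
    J · (λ e → ∑[ v < n ] crosses D (vertexCut v) e)
      ≡⟨ ·-cong (λ _ → refl) (λ e → trans (sum-cong-≗ (λ v → crosses-star D _ v e)) (∑-crosses-singleton D e)) ⟩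
    J · (λ _ → false)
      ≡⟨ ·-disjoint J (λ _ → false) (λ e → ∧-zeroʳ (J e)) ⟩
    false
      ∎)
    where open ≡-Reasoning

  module ContractionDijoin (e : Fin m) where

    J : Fin m → Bool
    J g = crosses D (singleton (src D e)) g xor crosses D (singleton (tgt D e)) g

    odd-on-star : ∀ v → crosses D (singleton v) e ≡ false → J · crosses D (singleton v) ≡ true
    odd-on-star v ve = begin
      J · crosses D (singleton v)
        ≡⟨ ·-distribʳ-xor (crosses D (singleton s)) (crosses D (singleton t)) (crosses D (singleton v)) ⟩
      crosses D (singleton s) · crosses D (singleton v) xor crosses D (singleton t) · crosses D (singleton v)
        ≡⟨ cong₂ _xor_ (·-vertexCuts (not-end s (crosses-source (src∈A e) e)))
                       (·-vertexCuts (not-end t (crosses-sink (tgt∉A e) e))) ⟩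
      (inA s xor inA v) xor (inA t xor inA v)
        ≡⟨ cong₂ (λ x y → (x xor inA v) xor (y xor inA v))
                 (dec-true (s ∈? A) (src∈A e)) (dec-false (t ∈? A) (tgt∉A e)) ⟩
      not (inA v) xor inA v
        ≡⟨ xor-inverseˡ (inA v) ⟩
      true
        ∎
      where
      open ≡-Reasoning
      s = src D e
      t = tgt D e
      not-end : ∀ w → crosses D (singleton w) e ≡ w ≡ᵇ w → w ≢ v
      not-end w we w≡v = true≢false (trans (sym (trans we (≡ᵇ-refl w)))
                                           (trans (cong (λ u → crosses D (singleton u) e) w≡v) ve))

    odd : IsContractionDijoin D e J
    odd X db Xe = let (v , X≗v) = directedBond-vertexCut X db in
      trans (·-cong (λ _ → refl) X≗v) (odd-on-star v (trans (sym (X≗v e)) Xe))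

  level : Fin n → ℕ
  level v = if inA v then 0 else 1

  graded : IsGrading D level
  graded f = cong₂ (λ x y → if x then 0 else suc (if y then 0 else 1))
                   (dec-false (tgt D f ∈? A) (tgt∉A f)) (sym (dec-true (src D f ∈? A) (src∈A f)))

  no-isolated : ∀ v → ∃ (Incident D v)
  no-isolated v with v ∈? A
  ... | yes v∈A = let (f , s , _) = complete v _ v∈A (proj₂ some-sink) in f , inj₁ s
  ... | no  v∉A = let (f , _ , t) = complete _ v (proj₂ some-source) v∉A in f , inj₂ t

  criticality : Criticality D
  criticality = record
    { level              = level
    ; graded             = graded
    ; simple             = simple
    ; no-isolated        = no-isolated
    ; contraction-dijoin = λ e → ContractionDijoin.J e , ContractionDijoin.odd e
    }

oneDirection-minimalObstruction : ∀ {n m} (D : Digraph n m) → IsOneDirection D → Odd n → IsMinimalObstruction D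
oneDirection-minimalObstruction D (A , 2≤∣A∣ , 2≤∣B∣ , A→B , complete , simple) odd-n =
  minimal-obstruction-criterion D (no-odd-dijoin odd-n) criticality
  where open OneDirection D A 2≤∣A∣ 2≤∣B∣ A→B complete simple

-- Diamonds

module Diamond {n m : ℕ} (D : Digraph n m) (h₁ h₂ : Fin n) (h₁≢h₂ : h₁ ≢ h₂) (5≤n : 5 ≤ n)
    (shape : ∀ x → x ≢ h₁ → x ≢ h₂ → OutToHubs D h₁ h₂ x ⊎ InFromHubs D h₁ h₂ x)
    (covered : ∀ e → ∃[ x ] (x ≢ h₁ × x ≢ h₂ × Incident D x e)) where

  -- indexing the hubs by Bool makes hub (not b) the other hub
  hub : Bool → Fin n
  hub true  = h₁
  hub false = h₂

  hub-≡ᵇ : ∀ c b → hub c ≡ᵇ hub b ≡ not (c xor b)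
  hub-≡ᵇ true  true  = ≡ᵇ-refl h₁
  hub-≡ᵇ true  false = ≢⇒≡ᵇ-false h₁≢h₂
  hub-≡ᵇ false true  = ≢⇒≡ᵇ-false (h₁≢h₂ ∘ sym)
  hub-≡ᵇ false false = ≡ᵇ-refl h₂

  hub-injective : ∀ {c b} → hub c ≡ hub b → c ≡ b
  hub-injective {true}  {true}  _ = refl
  hub-injective {true}  {false} p = ⊥-elim (h₁≢h₂ p)
  hub-injective {false} {true}  p = ⊥-elim (h₁≢h₂ (sym p))
  hub-injective {false} {false} _ = refl

  NonHub : Fin n → Set
  NonHub x = ∀ b → x ≢ hub b

  nonHub : ∀ {x} → x ≢ h₁ → x ≢ h₂ → NonHub x
  nonHub x≢h₁ _ true  = x≢h₁
  nonHub _ x≢h₂ false = x≢h₂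

  hub-or-nonHub : ∀ v → (∃[ c ] v ≡ hub c) ⊎ NonHub v
  hub-or-nonHub v with v ≟ h₁ | v ≟ h₂
  ... | yes v≡h₁ | _        = inj₁ (true , v≡h₁)
  ... | no  _    | yes v≡h₂ = inj₁ (false , v≡h₂)
  ... | no  v≢h₁ | no  v≢h₂ = inj₂ (nonHub v≢h₁ v≢h₂)

  hasOut : Fin n → Bool
  hasOut v = does (any? (λ f → src D f ≟ v))

  hasOut-true : ∀ f → hasOut (src D f) ≡ true
  hasOut-true f = dec-true (any? (λ g → src D g ≟ src D f)) (f , refl)

  Joins : Fin m → Fin n → Bool → Set
  Joins e x b = NonHub x × ((src D e ≡ x × tgt D e ≡ hub b × hasOut x ≡ true) ⊎
                            (src D e ≡ hub b × tgt D e ≡ x × hasOut x ≡ false))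

  joins-unique : ∀ {e x b x′ b′} → Joins e x b → Joins e x′ b′ → x ≡ x′ × b ≡ b′
  joins-unique (_ , inj₁ (s , t , _)) (_  , inj₁ (s′ , t′ , _)) = trans (sym s) s′ , hub-injective (trans (sym t) t′)
  joins-unique (_ , inj₂ (s , t , _)) (_  , inj₂ (s′ , t′ , _)) = trans (sym t) t′ , hub-injective (trans (sym s) s′)
  joins-unique (x , inj₁ (s , _ , _)) (_  , inj₂ (s′ , _ , _))  = ⊥-elim (x _ (trans (sym s) s′))
  joins-unique (_ , inj₂ (s , _ , _)) (x′ , inj₁ (s′ , _ , _))  = ⊥-elim (x′ _ (trans (sym s′) s))

  star-edges : ∀ {x} → NonHub x →
               ∃[ e₁ ] ∃[ e₂ ] (Joins e₁ x true × Joins e₂ x false × (∀ e → Incident D x e → e ≡ e₁ ⊎ e ≡ e₂))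
  star-edges {x} nh with shape x (nh true) (nh false)
  ... | inj₁ (e₁ , e₂ , s₁ , t₁ , s₂ , t₂ , only) =
    e₁ , e₂ , (nh , inj₁ (s₁ , t₁ , source s₁)) , (nh , inj₁ (s₂ , t₂ , source s₂)) , only
    where
    source : ∀ {f} → src D f ≡ x → hasOut x ≡ true
    source {f} s = trans (cong hasOut (sym s)) (hasOut-true f)
  ... | inj₂ (e₁ , e₂ , s₁ , t₁ , s₂ , t₂ , only) =
    e₁ , e₂ , (nh , inj₂ (s₁ , t₁ , sink)) , (nh , inj₂ (s₂ , t₂ , sink)) , only
    where
    sink : hasOut x ≡ false
    sink = dec-false (any? (λ f → src D f ≟ x)) λ (f , s) → case only f (inj₁ s) of λ
      { (inj₁ refl) → nh true  (trans (sym s) s₁)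
      ; (inj₂ refl) → nh false (trans (sym s) s₂) }

  joins-incident : ∀ {e x b} → Joins e x b → Incident D x e
  joins-incident (_ , inj₁ (s , _ , _)) = inj₁ s
  joins-incident (_ , inj₂ (_ , t , _)) = inj₂ t

  source-joins : ∀ {e x c} → Joins e x c → hasOut x ≡ true → src D e ≡ x
  source-joins (_ , inj₁ (s , _ , _)) _   = s
  source-joins (_ , inj₂ (_ , _ , o)) out = ⊥-elim (true≢false (trans (sym out) o))

  sink-joins : ∀ {e x c} → Joins e x c → hasOut x ≡ false → src D e ≡ hub c
  sink-joins (_ , inj₁ (_ , _ , o)) out = ⊥-elim (true≢false (trans (sym o) out))
  sink-joins (_ , inj₂ (s , _ , _)) _   = s

  joins : ∀ e → ∃[ x ] ∃[ b ] Joins e x b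
  joins e with covered e
  ... | x , x≢h₁ , x≢h₂ , incident with star-edges (nonHub x≢h₁ x≢h₂)
  ...   | e₁ , e₂ , j₁ , j₂ , only with only e incident
  ...     | inj₁ refl = x , true , j₁
  ...     | inj₂ refl = x , false , j₂

  nonHubEnd : Fin m → Fin n
  nonHubEnd e = proj₁ (joins e)

  side : Fin m → Bool
  side e = proj₁ (proj₂ (joins e))

  joins-ends : ∀ e → Joins e (nonHubEnd e) (side e)
  joins-ends e = proj₂ (proj₂ (joins e))

  link : ∀ {x} → NonHub x → ∀ b → ∃[ e ] Joins e x b
  link nh true  = let (e₁ , _ , j₁ , _) = star-edges nh in e₁ , j₁
  link nh false = let (_ , e₂ , _ , j₂ , _) = star-edges nh in e₂ , j₂

  joins-injective : ∀ {e f x b} → Joins e x b → Joins f x b → e ≡ f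
  joins-injective {e} {f} je jf with star-edges (proj₁ je)
  ... | e₁ , e₂ , j₁ , j₂ , only with only e (joins-incident je) | only f (joins-incident jf)
  ...   | inj₁ e≡e₁ | inj₁ f≡e₁ = trans e≡e₁ (sym f≡e₁)
  ...   | inj₂ e≡e₂ | inj₂ f≡e₂ = trans e≡e₂ (sym f≡e₂)
  ...   | inj₁ refl | inj₂ refl =
    ⊥-elim (true≢false (trans (proj₂ (joins-unique j₁ je)) (proj₂ (joins-unique jf j₂))))
  ...   | inj₂ refl | inj₁ refl =
    ⊥-elim (true≢false (trans (proj₂ (joins-unique j₁ jf)) (proj₂ (joins-unique je j₂))))

  crosses-joins : ∀ {e x b} → Joins e x b → ∀ X → crosses D X e ≡ X x xor X (hub b)
  crosses-joins (_ , inj₁ (s , t , _)) X = cong₂ _xor_ (cong X s) (cong X t)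
  crosses-joins {x = x} {b} (_ , inj₂ (s , t , _)) X =
    trans (cong₂ _xor_ (cong X s) (cong X t)) (xor-comm (X (hub b)) (X x))

  nonHubEnd-joins : ∀ {e x b} → Joins e x b → nonHubEnd e ≡ x
  nonHubEnd-joins j = proj₁ (joins-unique (joins-ends _) j)

  another-nonHub : ∀ v → ∃[ x ] (NonHub x × x ≢ v)
  another-nonHub v =
    let (x , x≢h₁ , x≢h₂ , x≢v) = avoid-three (≤-trans (s≤s (s≤s (s≤s (s≤s z≤n)))) 5≤n) h₁ h₂ v
    in x , nonHub x≢h₁ x≢h₂ , x≢v

  crosses-singleton-nonHub : ∀ {x} → NonHub x → ∀ e → crosses D (singleton x) e ≡ nonHubEnd e ≡ᵇ x
  crosses-singleton-nonHub nh e =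
    trans (crosses-joins (joins-ends e) (singleton _))
          (trans (cong ((nonHubEnd e ≡ᵇ _) xor_) (≢⇒≡ᵇ-false (λ p → nh (side e) (sym p)))) (xor-identityʳ _))

  vertexCut : Fin n → Fin n → Bool
  vertexCut x = star (not (hasOut x)) x

  connected : ∀ x → NonHub x → ∀ Y → crosses D Y ⊆ᵇ crosses D (singleton x) →
              ∀ u w → u ≢ x → w ≢ x → Y u ≡ Y w
  connected x nh Y Y⊆x u w u≢x w≢x = trans (to-h₁ u u≢x) (sym (to-h₁ w w≢x))
    where
    x′   = proj₁ (another-nonHub x)
    x′nh = proj₁ (proj₂ (another-nonHub x))
    x′≢x = proj₂ (proj₂ (another-nonHub x))

    along : ∀ {e y c} → Joins e y c → y ≢ x → Y y ≡ Y (hub c)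
    along {e} {y} {c} j y≢x = xor≡false⇒≡ (trans (sym (crosses-joins j Y)) (⊆ᵇ-false Y⊆x e (begin
      crosses D (singleton x) e   ≡⟨ crosses-joins j (singleton x) ⟩
      (y ≡ᵇ x) xor (hub c ≡ᵇ x)   ≡⟨ cong₂ _xor_ (≢⇒≡ᵇ-false y≢x) (≢⇒≡ᵇ-false (λ p → nh c (sym p))) ⟩
      false                       ∎)))
      where open ≡-Reasoning

    to-h₁ : ∀ u → u ≢ x → Y u ≡ Y h₁
    to-h₁ u u≢x with hub-or-nonHub u
    ... | inj₁ (c , refl) = trans (sym (along (proj₂ (link x′nh c)) x′≢x)) (along (proj₂ (link x′nh true)) x′≢x)
    ... | inj₂ nu = along (proj₂ (link nu true)) u≢x

  singleton-crossed : ∀ {x} → NonHub x → HasCrossingEdge D (singleton x)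
  singleton-crossed {x} nh = let (l , jl) = link nh true in
    l , trans (crosses-singleton-nonHub nh l) (trans (cong (_≡ᵇ x) (nonHubEnd-joins jl)) (≡ᵇ-refl x))

  vertexCut-directedBond : ∀ {x} → NonHub x → IsDirectedBond D (vertexCut x)
  vertexCut-directedBond {x} nh with hasOut x in out
  ... | true  = isBond-star D false x (singleton-crossed nh) (connected x nh) , isDirected-source-star D x no-in
    where
    no-in : ∀ f → tgt D f ≢ x
    no-in f t≡x with joins-ends f
    ... | _ , inj₁ (_ , t , _)  = nh (side f) (trans (sym t≡x) t)
    ... | _ , inj₂ (_ , t , hf) = true≢false (trans (sym out) (trans (cong hasOut (trans (sym t≡x) t)) hf))
  ... | false = isBond-star D true x (singleton-crossed nh) (connected x nh) , isDirected-sink-star D x no-out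
    where
    no-out : ∀ f → src D f ≢ x
    no-out f s≡x = true≢false (trans (sym (hasOut-true f)) (trans (cong hasOut s≡x) out))

  isHub : Fin n → Bool
  isHub v = (v ≡ᵇ h₁) ∨ (v ≡ᵇ h₂)

  hubSide : Bool → Fin n → Bool
  hubSide b v = if isHub v then v ≡ᵇ hub b else hasOut v

  isHub-hub : ∀ c → isHub (hub c) ≡ true
  isHub-hub true  = cong (_∨ (h₁ ≡ᵇ h₂)) (≡ᵇ-refl h₁)
  isHub-hub false = trans (cong (_∨ (h₂ ≡ᵇ h₂)) (≢⇒≡ᵇ-false (h₁≢h₂ ∘ sym))) (≡ᵇ-refl h₂)

  isHub-nonHub : ∀ {x} → NonHub x → isHub x ≡ false
  isHub-nonHub nh = cong₂ _∨_ (≢⇒≡ᵇ-false (nh true)) (≢⇒≡ᵇ-false (nh false))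

  hubSide-hub : ∀ b c → hubSide b (hub c) ≡ not (c xor b)
  hubSide-hub b c = trans (cong (if_then hub c ≡ᵇ hub b else hasOut (hub c)) (isHub-hub c)) (hub-≡ᵇ c b)

  hubSide-nonHub : ∀ {x} → NonHub x → ∀ b → hubSide b x ≡ hasOut x
  hubSide-nonHub {x} nh b = cong (if_then x ≡ᵇ hub b else hasOut x) (isHub-nonHub nh)

  crosses-hubSide : ∀ {e x c} → Joins e x c → ∀ b → crosses D (hubSide b) e ≡ hasOut x xor not (c xor b)
  crosses-hubSide {c = c} j b =
    trans (crosses-joins j (hubSide b)) (cong₂ _xor_ (hubSide-nonHub (proj₁ j) b) (hubSide-hub b c))

  hubSide-rigid : ∀ b Y → crosses D Y ⊆ᵇ crosses D (hubSide b) → ConstantOnSides D (hubSide b) Y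
  hubSide-rigid b Y Y⊆ u w same = trans (toward u) (trans (cong (Y ∘ facing) same) (sym (toward w)))
    where
    facing : Bool → Fin n
    facing s = hub (if s then b else not b)

    toward : ∀ v → Y v ≡ Y (facing (hubSide b v))
    toward v with hub-or-nonHub v
    ... | inj₁ (c , refl) = cong Y (trans (cong hub (own c b)) (cong facing (sym (hubSide-hub b c))))
      where
      own : ∀ c b → c ≡ (if not (c xor b) then b else not b)
      own true  true  = refl
      own true  false = refl
      own false true  = refl
      own false false = refl
    ... | inj₂ nv =
      let (l , jl) = link nv (if hasOut v then b else not b) in
      trans (xor≡false⇒≡ (trans (sym (crosses-joins jl Y))
                                (⊆ᵇ-false Y⊆ l (trans (crosses-hubSide jl b) (uncrossing (hasOut v) b)))))
            (cong (Y ∘ facing) (sym (hubSide-nonHub nv b)))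
      where
      uncrossing : ∀ k b → k xor not ((if k then b else not b) xor b) ≡ false
      uncrossing true  true  = refl
      uncrossing true  false = refl
      uncrossing false true  = refl
      uncrossing false false = refl

  hubSide-directed : ∀ b → IsDirectedᵇ D (hubSide b)
  hubSide-directed b e crossing with joins-ends e
  ... | nh , inj₁ (s , _ , out) = trans (cong (hubSide b) s) (trans (hubSide-nonHub nh b) out)
  ... | nh , inj₂ (s , _ , out) = trans (cong (hubSide b) s)
    (trans (cong (_xor hubSide b (hub (side e))) (sym (trans (hubSide-nonHub nh b) out)))
           (trans (sym (crosses-joins (joins-ends e) (hubSide b))) crossing))

  crosses-link-hubSide : ∀ {x} (nh : NonHub x) b →
                         crosses D (hubSide b) (proj₁ (link nh (hasOut x xor b))) ≡ true
  crosses-link-hubSide {x} nh b =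
    trans (crosses-hubSide (proj₂ (link nh (hasOut x xor b))) b) (value (hasOut x) b)
    where
    value : ∀ k b → k xor not ((k xor b) xor b) ≡ true
    value true  true  = refl
    value true  false = refl
    value false true  = refl
    value false false = refl

  hubSide-directedBond : ∀ b → IsDirectedBond D (hubSide b)
  hubSide-directedBond b =
    let (x , nh , _) = another-nonHub h₁
        crossed      = proj₁ (link nh (hasOut x xor b)) , crosses-link-hubSide nh b
    in bond-if-sides-rigid D crossed (hubSide-rigid b) , hubSide-directed b

  crosses-hubSide-not : ∀ b e → crosses D (hubSide (not b)) e ≡ not (crosses D (hubSide b) e)
  crosses-hubSide-not b e =
    trans (crosses-hubSide (joins-ends e) (not b))
          (trans (negated (hasOut (nonHubEnd e)) (side e) b) (cong not (sym (crosses-hubSide (joins-ends e) b))))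
    where
    negated : ∀ k s b → k xor not (s xor not b) ≡ not (k xor not (s xor b))
    negated true  true  true  = refl
    negated true  true  false = refl
    negated true  false true  = refl
    negated true  false false = refl
    negated false true  true  = refl
    negated false true  false = refl
    negated false false true  = refl
    negated false false false = refl

  separating-hubs : ∀ X b → IsDirectedᵇ D X → X (hub b) ≡ true → X (hub (not b)) ≡ false → X ≗ hubSide b
  separating-hubs X b dir Xb Xb′ v with hub-or-nonHub v
  ... | inj₁ (c , refl) = trans (on-hubs b c Xb Xb′) (sym (hubSide-hub b c))
    where
    on-hubs : ∀ b c → X (hub b) ≡ true → X (hub (not b)) ≡ false → X (hub c) ≡ not (c xor b)
    on-hubs true  true  Xb _   = Xb
    on-hubs true  false _  Xb′ = Xb′
    on-hubs false true  _  Xb′ = Xb′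
    on-hubs false false Xb _   = Xb
  ... | inj₂ nv = trans (on-nonHub (hasOut v) refl) (sym (hubSide-nonHub nv b))
    where
    on-nonHub : ∀ k → hasOut v ≡ k → X v ≡ k
    on-nonHub true out = ¬-not λ Xv →
      let (l , jl) = link nv b in
      true≢false (trans (sym (dir l (trans (crosses-joins jl X) (cong₂ _xor_ Xv Xb))))
                        (trans (cong X (source-joins jl out)) Xv))
    on-nonHub false out = ¬-not λ Xv →
      let (l , jl) = link nv (not b) in
      true≢false (trans (sym (dir l (trans (crosses-joins jl X) (cong₂ _xor_ Xv Xb′))))
                        (trans (cong X (sink-joins jl out)) Xb′))

  directedBond-classification : ∀ X → IsDirectedBond D X →
    (∃[ x ] (NonHub x × crosses D X ≗ crosses D (singleton x))) ⊎ (∃[ b ] X ≗ hubSide b)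
  directedBond-classification X (bond@((g , Xg) , _) , dir) with X h₁ Bool.≟ X h₂
  ... | yes same = inj₁ (x , nh , bond-cuts-≗ D X (singleton x) bond crossed sub)
    where
    x  = nonHubEnd g
    nh = proj₁ (joins-ends g)

    on-hubs : ∀ c → X (hub c) ≡ X h₁
    on-hubs true  = refl
    on-hubs false = sym same

    crosses-X : ∀ f → crosses D X f ≡ X (nonHubEnd f) xor X h₁
    crosses-X f = trans (crosses-joins (joins-ends f) X) (cong (X (nonHubEnd f) xor_) (on-hubs (side f)))

    crossed : HasCrossingEdge D (singleton x)
    crossed = g , trans (crosses-singleton-nonHub nh g) (≡ᵇ-refl x)

    sub : crosses D (singleton x) ⊆ᵇ crosses D X
    sub f xf = trans (crosses-X f)
      (trans (cong (λ y → X y xor X h₁) (≡ᵇ⇒≡ (trans (sym (crosses-singleton-nonHub nh f)) xf)))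
             (trans (sym (crosses-X g)) Xg))
  ... | no differ with X h₁ in X₁
  ...   | true  = inj₂ (true  , separating-hubs X true  dir X₁ (¬-not (differ ∘ sym)))
  ...   | false = inj₂ (false , separating-hubs X false dir (¬-not (differ ∘ sym)) X₁)

  ·-nonHubs : ∀ {x y} → NonHub x → NonHub y → x ≢ y → crosses D (singleton x) · crosses D (singleton y) ≡ false
  ·-nonHubs {x} {y} nx ny x≢y =
    trans (·-cong (crosses-singleton-nonHub nx) (crosses-singleton-nonHub ny))
          (·-disjoint (λ f → nonHubEnd f ≡ᵇ x) (λ f → nonHubEnd f ≡ᵇ y) (λ f → ≡ᵇ-∧-≢ x≢y (nonHubEnd f)))

  ·-nonHub-hubSide : ∀ {x} → NonHub x → ∀ b → crosses D (singleton x) · crosses D (hubSide b) ≡ true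
  ·-nonHub-hubSide {x} nh b =
    ·-single (crosses D (singleton x)) (crosses D (hubSide b)) l
      (trans (crosses-singleton-nonHub nh l) (trans (cong (_≡ᵇ x) (nonHubEnd-joins jl)) (≡ᵇ-refl x)))
      (crosses-link-hubSide nh b) unique
    where
    l  = proj₁ (link nh (hasOut x xor b))
    jl = proj₂ (link nh (hasOut x xor b))

    crossing-side : ∀ k s b → k xor not (s xor b) ≡ true → s ≡ k xor b
    crossing-side true  true  false _ = refl
    crossing-side true  false true  _ = refl
    crossing-side false true  true  _ = refl
    crossing-side false false false _ = refl
    crossing-side true  true  true  ()
    crossing-side true  false false ()
    crossing-side false true  false ()
    crossing-side false false true  ()

    unique : ∀ f → crosses D (singleton x) f ∧ crosses D (hubSide b) f ≡ true → f ≡ l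
    unique f crossing = joins-injective (subst₂ (Joins f) at-x at-side (joins-ends f)) jl
      where
      at-x : nonHubEnd f ≡ x
      at-x = ≡ᵇ⇒≡ (trans (sym (crosses-singleton-nonHub nh f)) (proj₁ (∧-true crossing)))
      at-side : side f ≡ hasOut x xor b
      at-side = trans (crossing-side (hasOut (nonHubEnd f)) (side f) b
                         (trans (sym (crosses-hubSide (joins-ends f) b)) (proj₂ (∧-true crossing))))
                      (cong (λ y → hasOut y xor b) at-x)

  ·-hubSides : ∀ b → crosses D (hubSide b) · crosses D (hubSide (not b)) ≡ false
  ·-hubSides b = ·-disjoint (crosses D (hubSide b)) (crosses D (hubSide (not b)))
    (λ f → trans (cong (crosses D (hubSide b) f ∧_) (crosses-hubSide-not b f))
                 (∧-inverseʳ (crosses D (hubSide b) f)))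

  isHub≡false⇒nonHub : ∀ {v} → isHub v ≡ false → NonHub v
  isHub≡false⇒nonHub {v} not-hub with hub-or-nonHub v
  ... | inj₁ (c , refl) = ⊥-elim (true≢false (trans (sym (isHub-hub c)) not-hub))
  ... | inj₂ nv         = nv

  ∑-nonHubs : ∑[ v < n ] not (isHub v) ≡ parity n
  ∑-nonHubs = begin
    ∑[ v < n ] not (isHub v)
      ≡⟨ sum-cong-≗ as-sum ⟩
    ∑[ v < n ] (true xor ((v ≡ᵇ h₁) xor (v ≡ᵇ h₂)))
      ≡⟨ ∑-distrib-+ (λ _ → true) (λ v → (v ≡ᵇ h₁) xor (v ≡ᵇ h₂)) ⟩
    ∑[ v < n ] true xor ∑[ v < n ] ((v ≡ᵇ h₁) xor (v ≡ᵇ h₂))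
      ≡⟨ cong₂ _xor_ (sum-true n) (trans (∑-distrib-+ (_≡ᵇ h₁) (_≡ᵇ h₂)) (cong₂ _xor_ (sum-≡ᵇ′ h₁) (sum-≡ᵇ′ h₂))) ⟩
    parity n xor false
      ≡⟨ xor-identityʳ (parity n) ⟩
    parity n
      ∎
    where
    open ≡-Reasoning
    as-sum : ∀ v → not (isHub v) ≡ true xor ((v ≡ᵇ h₁) xor (v ≡ᵇ h₂))
    as-sum v = trans (cong not (∨-disjoint {v ≡ᵇ h₁} (≡ᵇ-∧-≢ h₁≢h₂ v))) (sym (true-xor _))

  ∑-nonHub-stars : ∀ e → ∑[ v < n ] (not (isHub v) ∧ crosses D (vertexCut v) e) ≡ true
  ∑-nonHub-stars e = trans (sum-cong-≗ at) (sum-≡ᵇ (nonHubEnd e))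
    where
    at : ∀ v → not (isHub v) ∧ crosses D (vertexCut v) e ≡ nonHubEnd e ≡ᵇ v
    at v with hub-or-nonHub v
    ... | inj₁ (c , refl) = trans (cong (λ h → not h ∧ crosses D (vertexCut (hub c)) e) (isHub-hub c))
                                  (sym (≢⇒≡ᵇ-false (λ p → proj₁ (joins-ends e) c p)))
    ... | inj₂ nv = trans (cong (λ h → not h ∧ crosses D (vertexCut v) e) (isHub-nonHub nv))
                          (trans (crosses-star D _ v e) (crosses-singleton-nonHub nv e))

  hubSides-partition : ∀ e → crosses D (hubSide true) e xor crosses D (hubSide false) e ≡ true
  hubSides-partition e = trans (cong (crosses D (hubSide true) e xor_) (crosses-hubSide-not true e))
                               (xor-inverseʳ (crosses D (hubSide true) e))

  -- Counting J against the stars of the n − 2 non-hubs gives n ≡ |J| (mod 2), and against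
  -- the two hub sides gives |J| ≡ 0, as every edge has one non-hub end and lies in one hub side.
  no-odd-dijoin : Odd n → ¬ HasOddDijoinᵇ D
  no-odd-dijoin odd-n (J , odd) = true≢false (begin
    true
      ≡⟨ parity-odd n odd-n ⟨
    parity n
      ≡⟨ ∑-nonHubs ⟨
    ∑[ v < n ] not (isHub v)
      ≡⟨ odd-dijoin-counting D odd (not ∘ isHub) vertexCut
           (λ v nv → vertexCut-directedBond (isHub≡false⇒nonHub (not-injective nv))) ⟩
    J · (λ e → ∑[ v < n ] (not (isHub v) ∧ crosses D (vertexCut v) e))
      ≡⟨ ·-cong (λ _ → refl) (λ e → trans (∑-nonHub-stars e) (sym (hubSides-partition e))) ⟩
    J · (λ e → crosses D (hubSide true) e xor crosses D (hubSide false) e)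
      ≡⟨ ·-distribˡ-xor J (crosses D (hubSide true)) (crosses D (hubSide false)) ⟩
    J · crosses D (hubSide true) xor J · crosses D (hubSide false)
      ≡⟨ cong₂ _xor_ (odd (hubSide true) (hubSide-directedBond true))
                     (odd (hubSide false) (hubSide-directedBond false)) ⟩
    false
      ∎)
    where open ≡-Reasoning

  module ContractionDijoin (e : Fin m) where

    x₀ = nonHubEnd e
    n₀ = proj₁ (joins-ends e)
    bₑ = hasOut x₀ xor side e

    e-crosses-hubSide : crosses D (hubSide bₑ) e ≡ true
    e-crosses-hubSide = trans (crosses-hubSide (joins-ends e) bₑ) (value (hasOut x₀) (side e))
      where
      value : ∀ k s → k xor not (s xor (k xor s)) ≡ true
      value true  true  = refl
      value true  false = refl
      value false true  = refl
      value false false = refl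

    J : Fin m → Bool
    J g = crosses D (hubSide bₑ) g xor crosses D (singleton x₀) g

    ·-J : ∀ Y → J · Y ≡ crosses D (hubSide bₑ) · Y xor crosses D (singleton x₀) · Y
    ·-J = ·-distribʳ-xor (crosses D (hubSide bₑ)) (crosses D (singleton x₀))

    odd-on-star : ∀ {x} → NonHub x → crosses D (singleton x) e ≡ false → J · crosses D (singleton x) ≡ true
    odd-on-star {x} nx xe = trans (·-J (crosses D (singleton x)))
      (cong₂ _xor_ (trans (·-comm (crosses D (hubSide bₑ)) (crosses D (singleton x))) (·-nonHub-hubSide nx bₑ))
                   (·-nonHubs n₀ nx x₀≢x))
      where
      x₀≢x : x₀ ≢ x
      x₀≢x x₀≡x = true≢false (trans (sym (trans (crosses-singleton-nonHub nx e)
                                                 (trans (cong (_≡ᵇ x) x₀≡x) (≡ᵇ-refl x)))) xe)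

    odd-on-hubSide : ∀ b → crosses D (hubSide b) e ≡ false → J · crosses D (hubSide b) ≡ true
    odd-on-hubSide b be = trans (cong (λ c → J · crosses D (hubSide c)) b≡)
      (trans (·-J (crosses D (hubSide (not bₑ))))
             (cong₂ _xor_ (·-hubSides bₑ) (·-nonHub-hubSide n₀ (not bₑ))))
      where
      b≡ : b ≡ not bₑ
      b≡ = ¬-not λ b≡bₑ → true≢false (trans (sym e-crosses-hubSide)
                                            (trans (cong (λ c → crosses D (hubSide c) e) (sym b≡bₑ)) be))

    odd : IsContractionDijoin D e J
    odd X db Xe with directedBond-classification X db
    ... | inj₁ (x , nx , X≗x) = trans (·-cong (λ _ → refl) X≗x) (odd-on-star nx (trans (sym (X≗x e)) Xe))
    ... | inj₂ (b , X≗Z)      = trans (·-cong (λ _ → refl) (crosses-cong D X≗Z))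
                                      (odd-on-hubSide b (trans (sym (crosses-cong D X≗Z e)) Xe))

  level : Fin n → ℕ
  level v = if isHub v then 1 else if hasOut v then 0 else 2

  level-hub : ∀ c → level (hub c) ≡ 1
  level-hub c = cong (if_then 1 else (if hasOut (hub c) then 0 else 2)) (isHub-hub c)

  level-nonHub : ∀ {x} → NonHub x → level x ≡ (if hasOut x then 0 else 2)
  level-nonHub {x} nh = cong (if_then 1 else (if hasOut x then 0 else 2)) (isHub-nonHub nh)

  graded : IsGrading D level
  graded f with joins-ends f
  ... | nh , inj₁ (s , t , out) rewrite s | t =
    trans (level-hub (side f)) (sym (cong suc (trans (level-nonHub nh) (cong (if_then 0 else 2) out))))
  ... | nh , inj₂ (s , t , out) rewrite s | t =
    trans (level-nonHub nh) (trans (cong (if_then 0 else 2) out) (sym (cong suc (level-hub (side f)))))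

  simple : NoParallelEdges D
  simple e f s≡ t≡ = joins-injective (joins-ends e) (moved (joins-ends e))
    where
    moved : ∀ {x b} → Joins e x b → Joins f x b
    moved (nh , inj₁ (s , t , out)) = nh , inj₁ (trans (sym s≡) s , trans (sym t≡) t , out)
    moved (nh , inj₂ (s , t , out)) = nh , inj₂ (trans (sym s≡) s , trans (sym t≡) t , out)

  no-isolated : ∀ v → ∃ (Incident D v)
  no-isolated v with hub-or-nonHub v
  ... | inj₂ nv = let (l , jl) = link nv true in l , joins-incident jl
  ... | inj₁ (c , refl) with link (proj₁ (proj₂ (another-nonHub h₁))) c
  ...   | l , (_ , inj₁ (_ , t , _)) = l , inj₂ t
  ...   | l , (_ , inj₂ (s , _ , _)) = l , inj₁ s

  criticality : Criticality D
  criticality = record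
    { level              = level
    ; graded             = graded
    ; simple             = simple
    ; no-isolated        = no-isolated
    ; contraction-dijoin = λ e → ContractionDijoin.J e , ContractionDijoin.odd e
    }

diamond-minimalObstruction : ∀ {n m} (D : Digraph n m) → IsDiamond D → Odd n → IsMinimalObstruction D
diamond-minimalObstruction D (h₁ , h₂ , h₁≢h₂ , 5≤n , shape , covered) odd-n =
  minimal-obstruction-criterion D (no-odd-dijoin odd-n) criticality
  where open Diamond D h₁ h₂ h₁≢h₂ 5≤n shape covered

lemma4p16 : (∀ {n m} (D : Digraph n m) → IsDiamond D → Odd n → IsMinimalObstruction D)
          × (∀ {n m} (D : Digraph n m) → IsOneDirection D → Odd n → IsMinimalObstruction D)
lemma4p16 = diamond-minimalObstruction , oneDirection-minimalObstruction
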